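{- Let $K$ be a $(d-1)$-dimensional cubical complex. If the short cubical $h$-vector of $K$ is nonnegative, then so is the short cubical $h$-vector of its cubical barycentric subdivision $\mathrm{sd}_c(K)$.
   Context: A cubical complex is a finite collection $K$ of polytopes in $\mathbb{R}^n$, each combinatorially isomorphic to a cube $[0,1]^m$, closed under taking faces and such that any two intersect in a common face; $f_j(K)$ is its number of $j$-dimensional faces. For a $(d-1)$-dimensional cubical complex $K$, the short cubical $h$-vector $(h^{(sc)}_0(K),\ldots,h^{(sc)}_{d-1}(K))$ is defined by $\sum_{i=0}^{d-1} h^{(sc)}_i(K)x^i = \sum_{j=0}^{d-1} f_j(K)(2x)^j(1-x)^{d-1-j}$. A vector is nonnegative if all its entries are $\ge 0$. The cubical barycentric subdivision $\mathrm{sd}_c(K)$ is the cubical complex whose vertices are the barycenters of the nonempty faces of $K$ and whose nonempty faces are, for each closed interval $[F,G]$ in the poset of nonempty faces of $K$ ordered by inclusion, the convex hull of the barycenters of the faces in $[F,G]$; it has the same dimension as $K$. -}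

module Defs where

open import Data.Nat using (ℕ; zero; suc; _∸_; _<_; _≟_; _+_)
open import Data.Integer as ℤ using (ℤ; +_; _≤_)
open import Data.Bool using (Bool; true; false; if_then_else_)
open import Data.Maybe using (Maybe; just; nothing)
open import Data.Fin using (Fin)
open import Data.Fin.Subset using (Subset; inside; outside; _∩_; _⊆_; ⊥)
open import Data.Fin.Subset.Properties using (_⊆?_)
open import Data.Fin.Properties as FinP using ()
open import Data.Vec using (Vec; []; _∷_; tabulate)
open import Data.List using (List; []; _∷_; map; _++_; length; filter; filterᵇ; cartesianProduct)
open import Data.Bool.ListAction using (any)
open import Data.List.Membership.Propositional using (_∈_)
open import Data.List.Relation.Unary.Unique.Propositional using (Unique)
open import Data.Product using (Σ; ∃; ∃-syntax; _×_; _,_; proj₁; proj₂)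
open import Data.Sum using (_⊎_)
open import Relation.Binary.PropositionalEquality using (_≡_)
open import Relation.Nullary.Decidable using (⌊_⌋; does)

cubeVertices : (m : ℕ) → List (Vec Bool m)
cubeVertices zero    = [] ∷ []
cubeVertices (suc m) = map (false ∷_) (cubeVertices m) ++ map (true ∷_) (cubeVertices m)

-- A nonempty face of [0,1]^m: each coordinate is fixed (just b) or free (nothing).
CubeFace : ℕ → Set
CubeFace m = Vec (Maybe Bool) m

inCubeFace : ∀ {m} → CubeFace m → Vec Bool m → Bool
inCubeFace []             []       = true
inCubeFace (nothing ∷ p)  (_ ∷ c)  = inCubeFace p c
inCubeFace (just b ∷ p)   (b' ∷ c) = (if b then b' else Data.Bool.not b') Data.Bool.∧ inCubeFace p c

-- Cells: a cell of dimension m on vertex set Fin N is a labelling of the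
-- vertices of [0,1]^m by vertices of the complex.

Cell : ℕ → Set
Cell N = Σ ℕ λ m → (Vec Bool m → Fin N)

dim : ∀ {N} → Cell N → ℕ
dim = proj₁

faceImage : ∀ {N} (F : Cell N) → CubeFace (dim F) → Subset N
faceImage (m , φ) p =
  tabulate λ v → if any (λ c → inCubeFace p c Data.Bool.∧ ⌊ φ c FinP.≟ v ⌋) (cubeVertices m)
                 then inside else outside

vset : ∀ {N} → Cell N → Subset N
vset (m , φ) = faceImage (m , φ) (Data.Vec.replicate m nothing)

-- Faces are identified by their vertex
-- sets, which must be pairwise distinct.

record CubicalComplex (N : ℕ) : Set where
  field
    faces      : List (Cell N)
    injective  : ∀ {F} → F ∈ faces → ∀ c c' → proj₂ F c ≡ proj₂ F c' → c ≡ c'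
    distinct   : Unique (map vset faces)
    faceClosed : ∀ {F} → F ∈ faces → (p : CubeFace (dim F)) →
                 ∃[ G ] (G ∈ faces × vset G ≡ faceImage F p)
    intersect  : ∀ {F G} → F ∈ faces → G ∈ faces →
                 (vset F ∩ vset G ≡ ⊥) ⊎
                 (∃[ p ] ∃[ q ] (vset F ∩ vset G ≡ faceImage F p × vset F ∩ vset G ≡ faceImage G q))

open CubicalComplex public

HasDim : ∀ {N} → CubicalComplex N → ℕ → Set
HasDim K d = (∀ {F} → F ∈ faces K → dim F < d) × (∃[ F ] (F ∈ faces K × suc (dim F) ≡ d))

fvec : ∀ {N} → CubicalComplex N → ℕ → ℕ
fvec K j = length (filter (λ F → dim F ≟ j) (faces K))

-- f_j(sd_c K): the j-faces of sd_c(K) are the closed intervals [F,G] of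
-- the face poset of K (ordered by inclusion) with dim G - dim F = j.
fvecSd : ∀ {N} → CubicalComplex N → ℕ → ℕ
fvecSd K j = length (filterᵇ (λ FG → does (vset (proj₁ FG) ⊆? vset (proj₂ FG)) Data.Bool.∧
                                     does (dim (proj₂ FG) ≟ dim (proj₁ FG) + j))
                            (cartesianProduct (faces K) (faces K)))

-- Polynomials with integer coefficients as coefficient lists
-- (constant term first).

Poly : Set
Poly = List ℤ

_⊕_ : Poly → Poly → Poly
[]       ⊕ q        = q
(a ∷ p)  ⊕ []       = a ∷ p
(a ∷ p)  ⊕ (b ∷ q)  = (a ℤ.+ b) ∷ (p ⊕ q)

scale : ℤ → Poly → Poly
scale a = map (a ℤ.*_)

_⊗_ : Poly → Poly → Poly
[]      ⊗ q = []
(a ∷ p) ⊗ q = scale a q ⊕ (+ 0 ∷ (p ⊗ q))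

_^^_ : Poly → ℕ → Poly
p ^^ zero  = + 1 ∷ []
p ^^ suc n = p ⊗ (p ^^ n)

coeff : Poly → ℕ → ℤ
coeff []      _       = + 0
coeff (a ∷ p) zero    = a
coeff (a ∷ p) (suc i) = coeff p i

sumP : ℕ → (ℕ → Poly) → Poly
sumP zero    g = []
sumP (suc n) g = sumP n g ⊕ g n

hscPoly : ℕ → (ℕ → ℕ) → Poly
hscPoly d f = sumP d λ j →
  scale (+ f j) (((+ 0 ∷ + 2 ∷ []) ^^ j) ⊗ ((+ 1 ∷ ℤ.- (+ 1) ∷ []) ^^ (d ∸ 1 ∸ j)))

hsc : ℕ → (ℕ → ℕ) → ℕ → ℤ
hsc d f i = coeff (hscPoly d f) i

Nonneg : ℕ → (ℕ → ℕ) → Set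
Nonneg d f = ∀ i → i < d → + 0 ≤ hsc d f i

{-# OPTIONS --safe #-}
module Submission where

-- Write n = d - 1. A face of K of dimension m contributes (2x)^m (1-x)^(n-m) to the
-- short cubical h-polynomial of K. The j-faces [F,G] of sd_c(K) are, for each face G,
-- the faces of codimension j of the cube G, and summing (2x)^c (1-x)^(n-c) over the
-- faces of an m-cube (c the codimension) gives (1+3x)^m (1-x)^(n-m). Since the
-- substitution x ↦ (1+3x)/(3+x) sends 2x to 2(1+3x)/(3+x) and 1-x to 2(1-x)/(3+x),
--   2^n h_{sd_c K}(x) = (3+x)^n h_K((1+3x)/(3+x)),
-- and the right-hand side has nonnegative coefficients whenever h_K does.

open import Defs
open import Algebra.Properties.CommutativeSemigroup using (interchange)
open import Data.Bool using (Bool; true; false; if_then_else_; T; T?; _∧_; not)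
import Data.Bool.Properties as BP
open import Data.Bool.Properties using (T-≡; T-∧)
open import Data.Bool.ListAction using (any)
open import Data.Empty using (⊥-elim)
open import Data.Fin using (Fin)
import Data.Fin.Properties as FinP
import Data.Fin.Subset as Sb
import Data.Fin.Subset.Properties as SbP
open import Data.Integer as ℤ using (ℤ; +_; +0; -1ℤ; +≤+; _≤_)
import Data.Integer.Properties as ℤP
open import Data.List using (List; []; _∷_; map; _++_; drop; length; filter; filterᵇ; cartesianProduct)
open import Data.List.Properties using (length-map)
open import Data.List.Membership.Propositional using (_∈_; lose)
open import Data.List.Membership.Propositional.Properties
  using (∈-map⁺; ∈-map⁻; ∈-++⁺ˡ; ∈-++⁺ʳ; ∈-++⁻; ∈-filter⁺; ∈-filter⁻)
open import Data.List.Membership.Propositional.Properties.WithK using (unique∧set⇒bag)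
open import Data.List.Relation.Binary.BagAndSetEquality using (∼bag⇒↭)
open import Data.List.Relation.Binary.Permutation.Propositional.Properties using (↭-length)
open import Data.List.Relation.Unary.All using ([])
open import Data.List.Relation.Unary.AllPairs using ([]; _∷_)
import Data.List.Relation.Unary.AllPairs.Properties as AllPairsP
open import Data.List.Relation.Unary.Any using (here; there; satisfied)
open import Data.List.Relation.Unary.Any.Properties using (any⁺; any⁻)
open import Data.List.Relation.Unary.Unique.Propositional using (Unique)
import Data.List.Relation.Unary.Unique.Propositional.Properties as UniqueP
open import Data.Maybe using (Maybe; just; nothing)
open import Data.Nat as ℕ using (ℕ; zero; suc; _∸_; z≤n; s≤s; _≟_; _^_)
import Data.Nat.Properties as ℕP
open import Data.Nat.Logarithm using (⌊log₂_⌋; ⌊log₂[2^n]⌋≡n)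
open import Data.Product using (∃; _×_; _,_; proj₁; proj₂)
open import Data.Sum using (_⊎_; inj₁; inj₂; [_,_]′)
open import Data.Vec as V using (Vec; []; _∷_)
import Data.Vec.Properties as VP
open import Function.Bundles using (mk⇔; module Equivalence)
open import Level using (0ℓ)
open import Relation.Binary.Bundles using (Setoid)
open import Relation.Binary.PropositionalEquality
import Relation.Binary.Reasoning.Setoid as SetoidReasoning
open import Relation.Nullary using (¬_; Dec; does; yes; no)
open import Relation.Nullary.Decidable using (dec-true; dec-false; ⌊_⌋; toWitness; fromWitness)

-- Polynomials up to coefficientwise equality

infix 4 _≈_
record _≈_ (p q : Poly) : Set where
  constructor mk≈
  field coeff-≡ : ∀ i → coeff p i ≡ coeff q i
open _≈_

≈-refl : ∀ {p} → p ≈ p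
≈-refl = mk≈ λ i → refl

≈-sym : ∀ {p q} → p ≈ q → q ≈ p
≈-sym e = mk≈ λ i → sym (coeff-≡ e i)

≈-trans : ∀ {p q r} → p ≈ q → q ≈ r → p ≈ r
≈-trans e f = mk≈ λ i → trans (coeff-≡ e i) (coeff-≡ f i)

≈-setoid : Setoid 0ℓ 0ℓ
≈-setoid = record
  { Carrier = Poly ; _≈_ = _≈_
  ; isEquivalence = record { refl = ≈-refl ; sym = ≈-sym ; trans = ≈-trans } }

module ≈-Reasoning = SetoidReasoning ≈-setoid

coeff-⊕ : ∀ p q i → coeff (p ⊕ q) i ≡ coeff p i ℤ.+ coeff q i
coeff-⊕ []      q       i       = sym (ℤP.+-identityˡ (coeff q i))
coeff-⊕ (a ∷ p) []      i       = sym (ℤP.+-identityʳ (coeff (a ∷ p) i))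
coeff-⊕ (a ∷ p) (b ∷ q) zero    = refl
coeff-⊕ (a ∷ p) (b ∷ q) (suc i) = coeff-⊕ p q i

coeff-scale : ∀ a p i → coeff (scale a p) i ≡ a ℤ.* coeff p i
coeff-scale a []      i       = sym (ℤP.*-zeroʳ a)
coeff-scale a (b ∷ p) zero    = refl
coeff-scale a (b ∷ p) (suc i) = coeff-scale a p i

∷-cong : ∀ {a b p q} → a ≡ b → p ≈ q → a ∷ p ≈ b ∷ q
∷-cong e f = mk≈ λ { zero → e ; (suc i) → coeff-≡ f i }

∷-≈-tail : ∀ {a p q} → a ∷ p ≈ q → p ≈ drop 1 q
∷-≈-tail {q = []}    e = mk≈ λ i → coeff-≡ e (suc i)
∷-≈-tail {q = b ∷ q} e = mk≈ λ i → coeff-≡ e (suc i)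

0∷-≈[] : ∀ {p} → p ≈ [] → +0 ∷ p ≈ []
0∷-≈[] e = mk≈ λ { zero → refl ; (suc i) → coeff-≡ e i }

⊕-cong : ∀ {p p' q q'} → p ≈ p' → q ≈ q' → p ⊕ q ≈ p' ⊕ q'
⊕-cong {p} {p'} {q} {q'} e f = mk≈ λ i → begin
  coeff (p ⊕ q) i                ≡⟨ coeff-⊕ p q i ⟩
  coeff p i ℤ.+ coeff q i        ≡⟨ cong₂ ℤ._+_ (coeff-≡ e i) (coeff-≡ f i) ⟩
  coeff p' i ℤ.+ coeff q' i      ≡⟨ coeff-⊕ p' q' i ⟨
  coeff (p' ⊕ q') i              ∎
  where open ≡-Reasoning

⊕-congˡ : ∀ p {q q'} → q ≈ q' → p ⊕ q ≈ p ⊕ q'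
⊕-congˡ p = ⊕-cong (≈-refl {p})

⊕-congʳ : ∀ {p p'} q → p ≈ p' → p ⊕ q ≈ p' ⊕ q
⊕-congʳ q e = ⊕-cong e (≈-refl {q})

⊕-identityʳ : ∀ p → p ⊕ [] ≈ p
⊕-identityʳ []      = ≈-refl
⊕-identityʳ (a ∷ p) = ≈-refl

⊕-assoc : ∀ p q r → (p ⊕ q) ⊕ r ≈ p ⊕ (q ⊕ r)
⊕-assoc p q r = mk≈ λ i → begin
  coeff ((p ⊕ q) ⊕ r) i                     ≡⟨ coeff-⊕ (p ⊕ q) r i ⟩
  coeff (p ⊕ q) i ℤ.+ coeff r i             ≡⟨ cong (λ x → x ℤ.+ coeff r i) (coeff-⊕ p q i) ⟩
  coeff p i ℤ.+ coeff q i ℤ.+ coeff r i     ≡⟨ ℤP.+-assoc (coeff p i) _ _ ⟩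
  coeff p i ℤ.+ (coeff q i ℤ.+ coeff r i)   ≡⟨ cong (ℤ._+_ (coeff p i)) (coeff-⊕ q r i) ⟨
  coeff p i ℤ.+ coeff (q ⊕ r) i             ≡⟨ coeff-⊕ p (q ⊕ r) i ⟨
  coeff (p ⊕ (q ⊕ r)) i                     ∎
  where open ≡-Reasoning

⊕-interchange : ∀ a b c d → (a ⊕ b) ⊕ (c ⊕ d) ≈ (a ⊕ c) ⊕ (b ⊕ d)
⊕-interchange a b c d = mk≈ λ i → begin
  coeff ((a ⊕ b) ⊕ (c ⊕ d)) i                    ≡⟨ coeff-⊕ (a ⊕ b) (c ⊕ d) i ⟩
  coeff (a ⊕ b) i ℤ.+ coeff (c ⊕ d) i            ≡⟨ cong₂ ℤ._+_ (coeff-⊕ a b i) (coeff-⊕ c d i) ⟩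
  (coeff a i ℤ.+ coeff b i) ℤ.+ (coeff c i ℤ.+ coeff d i)
    ≡⟨ interchange ℤP.+-commutativeSemigroup (coeff a i) (coeff b i) (coeff c i) (coeff d i) ⟩
  (coeff a i ℤ.+ coeff c i) ℤ.+ (coeff b i ℤ.+ coeff d i)
    ≡⟨ cong₂ ℤ._+_ (coeff-⊕ a c i) (coeff-⊕ b d i) ⟨
  coeff (a ⊕ c) i ℤ.+ coeff (b ⊕ d) i            ≡⟨ coeff-⊕ (a ⊕ c) (b ⊕ d) i ⟨
  coeff ((a ⊕ c) ⊕ (b ⊕ d)) i                    ∎
  where open ≡-Reasoning

scale-cong : ∀ {a b p q} → a ≡ b → p ≈ q → scale a p ≈ scale b q
scale-cong {a} {_} {p} {q} refl e = mk≈ λ i → begin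
  coeff (scale a p) i   ≡⟨ coeff-scale a p i ⟩
  a ℤ.* coeff p i       ≡⟨ cong (a ℤ.*_) (coeff-≡ e i) ⟩
  a ℤ.* coeff q i       ≡⟨ coeff-scale a q i ⟨
  coeff (scale a q) i   ∎
  where open ≡-Reasoning

scale-congʳ : ∀ a {p q} → p ≈ q → scale a p ≈ scale a q
scale-congʳ a = scale-cong {a} refl

scale-congˡ : ∀ {a b} p → a ≡ b → scale a p ≈ scale b p
scale-congˡ p e = scale-cong e (≈-refl {p})

scale-distribˡ-⊕ : ∀ a p q → scale a (p ⊕ q) ≈ scale a p ⊕ scale a q
scale-distribˡ-⊕ a p q = mk≈ λ i → begin
  coeff (scale a (p ⊕ q)) i                     ≡⟨ coeff-scale a (p ⊕ q) i ⟩
  a ℤ.* coeff (p ⊕ q) i                         ≡⟨ cong (a ℤ.*_) (coeff-⊕ p q i) ⟩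
  a ℤ.* (coeff p i ℤ.+ coeff q i)               ≡⟨ ℤP.*-distribˡ-+ a (coeff p i) _ ⟩
  a ℤ.* coeff p i ℤ.+ a ℤ.* coeff q i           ≡⟨ cong₂ ℤ._+_ (coeff-scale a p i) (coeff-scale a q i) ⟨
  coeff (scale a p) i ℤ.+ coeff (scale a q) i   ≡⟨ coeff-⊕ (scale a p) (scale a q) i ⟨
  coeff (scale a p ⊕ scale a q) i               ∎
  where open ≡-Reasoning

scale-distribʳ-+ : ∀ a b p → scale (a ℤ.+ b) p ≈ scale a p ⊕ scale b p
scale-distribʳ-+ a b p = mk≈ λ i → begin
  coeff (scale (a ℤ.+ b) p) i                   ≡⟨ coeff-scale (a ℤ.+ b) p i ⟩
  (a ℤ.+ b) ℤ.* coeff p i                       ≡⟨ ℤP.*-distribʳ-+ (coeff p i) a b ⟩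
  a ℤ.* coeff p i ℤ.+ b ℤ.* coeff p i           ≡⟨ cong₂ ℤ._+_ (coeff-scale a p i) (coeff-scale b p i) ⟨
  coeff (scale a p) i ℤ.+ coeff (scale b p) i   ≡⟨ coeff-⊕ (scale a p) (scale b p) i ⟨
  coeff (scale a p ⊕ scale b p) i               ∎
  where open ≡-Reasoning

scale-assoc : ∀ a b p → scale a (scale b p) ≈ scale (a ℤ.* b) p
scale-assoc a b p = mk≈ λ i → begin
  coeff (scale a (scale b p)) i   ≡⟨ coeff-scale a (scale b p) i ⟩
  a ℤ.* coeff (scale b p) i       ≡⟨ cong (a ℤ.*_) (coeff-scale b p i) ⟩
  a ℤ.* (b ℤ.* coeff p i)         ≡⟨ ℤP.*-assoc a b _ ⟨
  (a ℤ.* b) ℤ.* coeff p i         ≡⟨ coeff-scale (a ℤ.* b) p i ⟨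
  coeff (scale (a ℤ.* b) p) i     ∎
  where open ≡-Reasoning

scale-zero : ∀ p → scale +0 p ≈ []
scale-zero p = mk≈ λ i → trans (coeff-scale +0 p i) (ℤP.*-zeroˡ (coeff p i))

scale-identity : ∀ p → scale (+ 1) p ≈ p
scale-identity p = mk≈ λ i → trans (coeff-scale (+ 1) p i) (ℤP.*-identityˡ (coeff p i))

scale-0∷ : ∀ a p → scale a (+0 ∷ p) ≈ +0 ∷ scale a p
scale-0∷ a p = ∷-cong (ℤP.*-zeroʳ a) ≈-refl

⊗-zeroʳ : ∀ p → p ⊗ [] ≈ []
⊗-zeroʳ []      = ≈-refl
⊗-zeroʳ (a ∷ p) = 0∷-≈[] (⊗-zeroʳ p)

≈[]⇒⊗≈[] : ∀ {p} q → p ≈ [] → p ⊗ q ≈ []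
≈[]⇒⊗≈[] {[]}    q e = ≈-refl
≈[]⇒⊗≈[] {a ∷ p} q e = begin
  scale a q ⊕ (+0 ∷ p ⊗ q)
    ≈⟨ ⊕-cong (scale-congˡ q (coeff-≡ e 0)) (∷-cong refl (≈[]⇒⊗≈[] q (∷-≈-tail e))) ⟩
  scale +0 q ⊕ (+0 ∷ [])
    ≈⟨ ⊕-congʳ (+0 ∷ []) (scale-zero q) ⟩
  +0 ∷ []
    ≈⟨ 0∷-≈[] ≈-refl ⟩
  [] ∎
  where open ≈-Reasoning

⊗-congˡ : ∀ {p p'} q → p ≈ p' → p ⊗ q ≈ p' ⊗ q
⊗-congˡ {[]}    {[]}     q e = ≈-refl
⊗-congˡ {[]}    {b ∷ p'} q e = ≈-sym (≈[]⇒⊗≈[] q (≈-sym e))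
⊗-congˡ {a ∷ p} {[]}     q e = ≈[]⇒⊗≈[] q e
⊗-congˡ {a ∷ p} {b ∷ p'} q e =
  ⊕-cong (scale-congˡ q (coeff-≡ e 0)) (∷-cong refl (⊗-congˡ q (∷-≈-tail e)))

⊗-congʳ : ∀ p {q q'} → q ≈ q' → p ⊗ q ≈ p ⊗ q'
⊗-congʳ []      e = ≈-refl
⊗-congʳ (a ∷ p) e = ⊕-cong (scale-congʳ a e) (∷-cong refl (⊗-congʳ p e))

⊗-distribʳ : ∀ p p' q → (p ⊕ p') ⊗ q ≈ (p ⊗ q) ⊕ (p' ⊗ q)
⊗-distribʳ []      p'       q = ≈-refl
⊗-distribʳ (a ∷ p) []       q = ≈-sym (⊕-identityʳ _)
⊗-distribʳ (a ∷ p) (b ∷ p') q = begin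
  scale (a ℤ.+ b) q ⊕ (+0 ∷ (p ⊕ p') ⊗ q)
    ≈⟨ ⊕-cong (scale-distribʳ-+ a b q) (∷-cong refl (⊗-distribʳ p p' q)) ⟩
  (scale a q ⊕ scale b q) ⊕ ((+0 ∷ p ⊗ q) ⊕ (+0 ∷ p' ⊗ q))
    ≈⟨ ⊕-interchange (scale a q) (scale b q) _ _ ⟩
  (scale a q ⊕ (+0 ∷ p ⊗ q)) ⊕ (scale b q ⊕ (+0 ∷ p' ⊗ q)) ∎
  where open ≈-Reasoning

⊗-distribˡ : ∀ p q q' → p ⊗ (q ⊕ q') ≈ (p ⊗ q) ⊕ (p ⊗ q')
⊗-distribˡ []      q q' = ≈-refl
⊗-distribˡ (a ∷ p) q q' = begin
  scale a (q ⊕ q') ⊕ (+0 ∷ p ⊗ (q ⊕ q'))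
    ≈⟨ ⊕-cong (scale-distribˡ-⊕ a q q') (∷-cong refl (⊗-distribˡ p q q')) ⟩
  (scale a q ⊕ scale a q') ⊕ ((+0 ∷ p ⊗ q) ⊕ (+0 ∷ p ⊗ q'))
    ≈⟨ ⊕-interchange (scale a q) (scale a q') _ _ ⟩
  (scale a q ⊕ (+0 ∷ p ⊗ q)) ⊕ (scale a q' ⊕ (+0 ∷ p ⊗ q')) ∎
  where open ≈-Reasoning

⊗-scaleˡ : ∀ a p q → scale a p ⊗ q ≈ scale a (p ⊗ q)
⊗-scaleˡ a []      q = ≈-refl
⊗-scaleˡ a (b ∷ p) q = begin
  scale (a ℤ.* b) q ⊕ (+0 ∷ scale a p ⊗ q)
    ≈⟨ ⊕-cong (≈-sym (scale-assoc a b q)) (∷-cong refl (⊗-scaleˡ a p q)) ⟩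
  scale a (scale b q) ⊕ (+0 ∷ scale a (p ⊗ q))
    ≈⟨ ⊕-congˡ (scale a (scale b q)) (≈-sym (scale-0∷ a (p ⊗ q))) ⟩
  scale a (scale b q) ⊕ scale a (+0 ∷ p ⊗ q)
    ≈⟨ ≈-sym (scale-distribˡ-⊕ a (scale b q) (+0 ∷ p ⊗ q)) ⟩
  scale a (scale b q ⊕ (+0 ∷ p ⊗ q)) ∎
  where open ≈-Reasoning

⊗-0∷ˡ : ∀ p q → (+0 ∷ p) ⊗ q ≈ +0 ∷ (p ⊗ q)
⊗-0∷ˡ p q = ⊕-congʳ (+0 ∷ p ⊗ q) (scale-zero q)

⊗-0∷ʳ : ∀ p q → p ⊗ (+0 ∷ q) ≈ +0 ∷ (p ⊗ q)
⊗-0∷ʳ []      q = ≈-sym (0∷-≈[] ≈-refl)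
⊗-0∷ʳ (a ∷ p) q = ⊕-cong (scale-0∷ a q) (∷-cong refl (⊗-0∷ʳ p q))

⊗-singletonʳ : ∀ p a → p ⊗ (a ∷ []) ≈ scale a p
⊗-singletonʳ []      a = ≈-refl
⊗-singletonʳ (b ∷ p) a =
  ∷-cong (trans (ℤP.+-identityʳ (b ℤ.* a)) (ℤP.*-comm b a)) (⊗-singletonʳ p a)

⊗-comm : ∀ p q → p ⊗ q ≈ q ⊗ p
⊗-comm []      q = ≈-sym (⊗-zeroʳ q)
⊗-comm (a ∷ p) q = begin
  scale a q ⊕ (+0 ∷ p ⊗ q)        ≈⟨ ⊕-cong (≈-sym (⊗-singletonʳ q a)) (∷-cong refl (⊗-comm p q)) ⟩
  (q ⊗ (a ∷ [])) ⊕ (+0 ∷ q ⊗ p)   ≈⟨ ⊕-congˡ (q ⊗ (a ∷ [])) (≈-sym (⊗-0∷ʳ q p)) ⟩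
  (q ⊗ (a ∷ [])) ⊕ (q ⊗ (+0 ∷ p)) ≈⟨ ⊗-distribˡ q _ _ ⟨
  q ⊗ ((a ∷ []) ⊕ (+0 ∷ p))       ≈⟨ ⊗-congʳ q (∷-cong (ℤP.+-identityʳ a) ≈-refl) ⟩
  q ⊗ (a ∷ p)                     ∎
  where open ≈-Reasoning

⊗-assoc : ∀ p q r → (p ⊗ q) ⊗ r ≈ p ⊗ (q ⊗ r)
⊗-assoc []      q r = ≈-refl
⊗-assoc (a ∷ p) q r = begin
  (scale a q ⊕ (+0 ∷ p ⊗ q)) ⊗ r        ≈⟨ ⊗-distribʳ (scale a q) _ r ⟩
  (scale a q ⊗ r) ⊕ ((+0 ∷ p ⊗ q) ⊗ r)  ≈⟨ ⊕-cong (⊗-scaleˡ a q r) (⊗-0∷ˡ (p ⊗ q) r) ⟩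
  scale a (q ⊗ r) ⊕ (+0 ∷ (p ⊗ q) ⊗ r)  ≈⟨ ⊕-congˡ (scale a (q ⊗ r)) (∷-cong refl (⊗-assoc p q r)) ⟩
  scale a (q ⊗ r) ⊕ (+0 ∷ p ⊗ (q ⊗ r))  ∎
  where open ≈-Reasoning

⊗-scaleʳ : ∀ a p q → p ⊗ scale a q ≈ scale a (p ⊗ q)
⊗-scaleʳ a p q = begin
  p ⊗ scale a q     ≈⟨ ⊗-comm p _ ⟩
  scale a q ⊗ p     ≈⟨ ⊗-scaleˡ a q p ⟩
  scale a (q ⊗ p)   ≈⟨ scale-congʳ a (⊗-comm q p) ⟩
  scale a (p ⊗ q)   ∎
  where open ≈-Reasoning

⊗-identityˡ : ∀ q → (+ 1 ∷ []) ⊗ q ≈ q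
⊗-identityˡ q = ≈-trans (⊕-cong (scale-identity q) (0∷-≈[] ≈-refl)) (⊕-identityʳ q)

x⊗yz≈y⊗xz : ∀ p q r → p ⊗ (q ⊗ r) ≈ q ⊗ (p ⊗ r)
x⊗yz≈y⊗xz p q r = begin
  p ⊗ (q ⊗ r)   ≈⟨ ⊗-assoc p q r ⟨
  (p ⊗ q) ⊗ r   ≈⟨ ⊗-congˡ r (⊗-comm p q) ⟩
  (q ⊗ p) ⊗ r   ≈⟨ ⊗-assoc q p r ⟩
  q ⊗ (p ⊗ r)   ∎
  where open ≈-Reasoning

Deg≤ : ℕ → Poly → Set
Deg≤ n p = ∀ k → n ℕ.< k → coeff p k ≡ +0

Deg≤-[] : ∀ n → Deg≤ n []
Deg≤-[] n k _ = refl

Deg≤-resp-≈ : ∀ {n p q} → p ≈ q → Deg≤ n p → Deg≤ n q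
Deg≤-resp-≈ e D k lt = trans (sym (coeff-≡ e k)) (D k lt)

Deg≤-mono : ∀ {m n p} → m ℕ.≤ n → Deg≤ m p → Deg≤ n p
Deg≤-mono m≤n D k lt = D k (ℕP.≤-<-trans m≤n lt)

Deg≤-tail : ∀ n {a p} → Deg≤ (suc n) (a ∷ p) → Deg≤ n p
Deg≤-tail n D k lt = D (suc k) (s≤s lt)

Deg≤0-tail : ∀ {a p} → Deg≤ 0 (a ∷ p) → p ≈ []
Deg≤0-tail D = mk≈ λ k → D (suc k) (s≤s z≤n)

Deg≤-∷ : ∀ {n p} a → Deg≤ n p → Deg≤ (suc n) (a ∷ p)
Deg≤-∷ a D (suc k) (s≤s lt) = D k lt

Deg≤-⊕ : ∀ {n p q} → Deg≤ n p → Deg≤ n q → Deg≤ n (p ⊕ q)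
Deg≤-⊕ {p = p} {q} Dp Dq k lt = trans (coeff-⊕ p q k) (cong₂ ℤ._+_ (Dp k lt) (Dq k lt))

Deg≤-scale : ∀ {n p} a → Deg≤ n p → Deg≤ n (scale a p)
Deg≤-scale {p = p} a D k lt = trans (coeff-scale a p k) (trans (cong (a ℤ.*_) (D k lt)) (ℤP.*-zeroʳ a))

Deg≤-⊗ : ∀ m n p q → Deg≤ m p → Deg≤ n q → Deg≤ (m ℕ.+ n) (p ⊗ q)
Deg≤-⊗ m n []      q Dp Dq = Deg≤-[] _
Deg≤-⊗ m n (c ∷ p) q Dp Dq =
  Deg≤-⊕ {p = scale c q} (Deg≤-mono {p = scale c q} (ℕP.m≤n+m n m) (Deg≤-scale {p = q} c Dq)) (shifted m Dp)
  where
  shifted : ∀ m → Deg≤ m (c ∷ p) → Deg≤ (m ℕ.+ n) (+0 ∷ p ⊗ q)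
  shifted zero    D = Deg≤-resp-≈ (≈-sym (0∷-≈[] (≈[]⇒⊗≈[] q (Deg≤0-tail D)))) (Deg≤-[] _)
  shifted (suc m) D = Deg≤-∷ +0 (Deg≤-⊗ m n p q (Deg≤-tail m D) Dq)

Deg≤-^^ : ∀ p m → Deg≤ 1 p → Deg≤ m (p ^^ m)
Deg≤-^^ p zero    D (suc k) _ = refl
Deg≤-^^ p (suc m) D = Deg≤-⊗ 1 m p (p ^^ m) D (Deg≤-^^ p m D)

Deg≤-sumP : ∀ n d g → (∀ j → j ℕ.< d → Deg≤ n (g j)) → Deg≤ n (sumP d g)
Deg≤-sumP n zero    g D = Deg≤-[] n
Deg≤-sumP n (suc d) g D =
  Deg≤-⊕ {p = sumP d g} (Deg≤-sumP n d g (λ j lt → D j (ℕP.m<n⇒m<1+n lt))) (D d ℕP.≤-refl)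

NonnegCoeffs : Poly → Set
NonnegCoeffs p = ∀ i → + 0 ≤ coeff p i

0≤i+j : ∀ {i j} → + 0 ≤ i → + 0 ≤ j → + 0 ≤ i ℤ.+ j
0≤i+j = ℤP.+-mono-≤

0≤i*j : ∀ {i j} → + 0 ≤ i → + 0 ≤ j → + 0 ≤ i ℤ.* j
0≤i*j (+≤+ {n = m} _) (+≤+ {n = n} _) = subst (+ 0 ≤_) (ℤP.pos-* m n) (+≤+ z≤n)

NonnegCoeffs-resp-≈ : ∀ {p q} → p ≈ q → NonnegCoeffs p → NonnegCoeffs q
NonnegCoeffs-resp-≈ e N i = subst (+ 0 ≤_) (coeff-≡ e i) (N i)

NonnegCoeffs-[] : NonnegCoeffs []
NonnegCoeffs-[] i = +≤+ z≤n

NonnegCoeffs-∷ : ∀ a p → + 0 ≤ a → NonnegCoeffs p → NonnegCoeffs (a ∷ p)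
NonnegCoeffs-∷ a p a≥0 N zero    = a≥0
NonnegCoeffs-∷ a p a≥0 N (suc i) = N i

NonnegCoeffs-⊕ : ∀ p q → NonnegCoeffs p → NonnegCoeffs q → NonnegCoeffs (p ⊕ q)
NonnegCoeffs-⊕ p q Np Nq i = subst (+ 0 ≤_) (sym (coeff-⊕ p q i)) (0≤i+j (Np i) (Nq i))

NonnegCoeffs-scale : ∀ a p → + 0 ≤ a → NonnegCoeffs p → NonnegCoeffs (scale a p)
NonnegCoeffs-scale a p a≥0 N i = subst (+ 0 ≤_) (sym (coeff-scale a p i)) (0≤i*j a≥0 (N i))

NonnegCoeffs-⊗ : ∀ p q → NonnegCoeffs p → NonnegCoeffs q → NonnegCoeffs (p ⊗ q)
NonnegCoeffs-⊗ []      q Np Nq = NonnegCoeffs-[]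
NonnegCoeffs-⊗ (c ∷ p) q Np Nq =
  NonnegCoeffs-⊕ (scale c q) (+0 ∷ p ⊗ q) (NonnegCoeffs-scale c q (Np 0) Nq)
    (NonnegCoeffs-∷ +0 (p ⊗ q) (+≤+ z≤n) (NonnegCoeffs-⊗ p q (λ i → Np (suc i)) Nq))

NonnegCoeffs-^^ : ∀ p m → NonnegCoeffs p → NonnegCoeffs (p ^^ m)
NonnegCoeffs-^^ p zero    N = NonnegCoeffs-∷ (+ 1) [] (+≤+ z≤n) NonnegCoeffs-[]
NonnegCoeffs-^^ p (suc m) N = NonnegCoeffs-⊗ p (p ^^ m) N (NonnegCoeffs-^^ p m N)

ΣP : ∀ {A : Set} → List A → (A → Poly) → Poly
ΣP []       g = []
ΣP (x ∷ xs) g = g x ⊕ ΣP xs g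

ΣP-cong : ∀ {A : Set} (xs : List A) {g h} → (∀ {x} → x ∈ xs → g x ≈ h x) → ΣP xs g ≈ ΣP xs h
ΣP-cong []       e = ≈-refl
ΣP-cong (x ∷ xs) e = ⊕-cong (e (here refl)) (ΣP-cong xs (λ x∈ → e (there x∈)))

ΣP-++ : ∀ {A : Set} (xs ys : List A) g → ΣP (xs ++ ys) g ≈ ΣP xs g ⊕ ΣP ys g
ΣP-++ []       ys g = ≈-refl
ΣP-++ (x ∷ xs) ys g =
  ≈-trans (⊕-congˡ (g x) (ΣP-++ xs ys g)) (≈-sym (⊕-assoc (g x) (ΣP xs g) (ΣP ys g)))

ΣP-map : ∀ {A B : Set} (f : A → B) (xs : List A) g → ΣP (map f xs) g ≡ ΣP xs (λ x → g (f x))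
ΣP-map f []       g = refl
ΣP-map f (x ∷ xs) g = cong (g (f x) ⊕_) (ΣP-map f xs g)

⊗-ΣP : ∀ {A : Set} c (xs : List A) g → c ⊗ ΣP xs g ≈ ΣP xs (λ x → c ⊗ g x)
⊗-ΣP c []       g = ⊗-zeroʳ c
⊗-ΣP c (x ∷ xs) g = ≈-trans (⊗-distribˡ c (g x) (ΣP xs g)) (⊕-congˡ (c ⊗ g x) (⊗-ΣP c xs g))

scale-ΣP : ∀ {A : Set} c (xs : List A) g → scale c (ΣP xs g) ≈ ΣP xs (λ x → scale c (g x))
scale-ΣP c []       g = ≈-refl
scale-ΣP c (x ∷ xs) g =
  ≈-trans (scale-distribˡ-⊕ c (g x) (ΣP xs g)) (⊕-congˡ (scale c (g x)) (scale-ΣP c xs g))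

Σℕ : ∀ {A : Set} → List A → (A → ℕ) → ℕ
Σℕ []       g = 0
Σℕ (x ∷ xs) g = g x ℕ.+ Σℕ xs g

Σℕ-cong : ∀ {A : Set} (xs : List A) {f g : A → ℕ} →
          (∀ {x} → x ∈ xs → f x ≡ g x) → Σℕ xs f ≡ Σℕ xs g
Σℕ-cong []       e = refl
Σℕ-cong (x ∷ xs) e = cong₂ ℕ._+_ (e (here refl)) (Σℕ-cong xs (λ x∈ → e (there x∈)))

Σℕ-zero : ∀ {A : Set} (xs : List A) → Σℕ xs (λ _ → 0) ≡ 0
Σℕ-zero []       = refl
Σℕ-zero (x ∷ xs) = Σℕ-zero xs

Σℕ-++ : ∀ {A : Set} (xs ys : List A) f → Σℕ (xs ++ ys) f ≡ Σℕ xs f ℕ.+ Σℕ ys f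
Σℕ-++ []       ys f = refl
Σℕ-++ (x ∷ xs) ys f = trans (cong (f x ℕ.+_) (Σℕ-++ xs ys f)) (sym (ℕP.+-assoc (f x) _ _))

Σℕ-map : ∀ {A B : Set} (g : A → B) (xs : List A) f → Σℕ (map g xs) f ≡ Σℕ xs (λ x → f (g x))
Σℕ-map g []       f = refl
Σℕ-map g (x ∷ xs) f = cong (f (g x) ℕ.+_) (Σℕ-map g xs f)

Σℕ-+ : ∀ {A : Set} (xs : List A) f g → Σℕ xs (λ x → f x ℕ.+ g x) ≡ Σℕ xs f ℕ.+ Σℕ xs g
Σℕ-+ []       f g = refl
Σℕ-+ (x ∷ xs) f g = trans (cong (f x ℕ.+ g x ℕ.+_) (Σℕ-+ xs f g))
                          (interchange ℕP.+-commutativeSemigroup (f x) (g x) _ _)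

Σℕ-swap : ∀ {A B : Set} (xs : List A) (ys : List B) (f : A → B → ℕ) →
          Σℕ xs (λ x → Σℕ ys (f x)) ≡ Σℕ ys (λ y → Σℕ xs (λ x → f x y))
Σℕ-swap []       ys f = sym (Σℕ-zero ys)
Σℕ-swap (x ∷ xs) ys f =
  trans (cong (Σℕ ys (f x) ℕ.+_) (Σℕ-swap xs ys f)) (sym (Σℕ-+ ys (f x) (λ y → Σℕ xs (λ x → f x y))))

Σℕ-cartesianProduct : ∀ {A B : Set} (xs : List A) (ys : List B) f →
                      Σℕ (cartesianProduct xs ys) f ≡ Σℕ xs (λ x → Σℕ ys (λ y → f (x , y)))
Σℕ-cartesianProduct []       ys f = refl
Σℕ-cartesianProduct (x ∷ xs) ys f =
  trans (Σℕ-++ (map (x ,_) ys) (cartesianProduct xs ys) f)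
        (cong₂ ℕ._+_ (Σℕ-map (x ,_) ys f) (Σℕ-cartesianProduct xs ys f))

indicator : Bool → ℕ
indicator b = if b then 1 else 0

length-filterᵇ : ∀ {A : Set} (p : A → Bool) xs → length (filterᵇ p xs) ≡ Σℕ xs (λ x → indicator (p x))
length-filterᵇ p []       = refl
length-filterᵇ p (x ∷ xs) with p x
... | true  = cong suc (length-filterᵇ p xs)
... | false = length-filterᵇ p xs

length-filterᵇ-cartesianProduct : ∀ {A B : Set} (p : A × B → Bool) xs ys →
  length (filterᵇ p (cartesianProduct xs ys)) ≡ Σℕ ys (λ y → length (filterᵇ (λ x → p (x , y)) xs))
length-filterᵇ-cartesianProduct p xs ys = begin
  length (filterᵇ p (cartesianProduct xs ys))
    ≡⟨ length-filterᵇ p (cartesianProduct xs ys) ⟩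
  Σℕ (cartesianProduct xs ys) (λ z → indicator (p z))
    ≡⟨ Σℕ-cartesianProduct xs ys (λ z → indicator (p z)) ⟩
  Σℕ xs (λ x → Σℕ ys (λ y → indicator (p (x , y))))
    ≡⟨ Σℕ-swap xs ys (λ x y → indicator (p (x , y))) ⟩
  Σℕ ys (λ y → Σℕ xs (λ x → indicator (p (x , y))))
    ≡⟨ Σℕ-cong ys (λ {y} _ → length-filterᵇ (λ x → p (x , y)) xs) ⟨
  Σℕ ys (λ y → length (filterᵇ (λ x → p (x , y)) xs)) ∎
  where open ≡-Reasoning

Unique-sameElements⇒length≡ : ∀ {A : Set} {xs ys : List A} → Unique xs → Unique ys →
  (∀ {z} → z ∈ xs → z ∈ ys) → (∀ {z} → z ∈ ys → z ∈ xs) → length xs ≡ length ys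
Unique-sameElements⇒length≡ ux uy to from = ↭-length (∼bag⇒↭ (unique∧set⇒bag ux uy (mk⇔ to from)))

countBy : ∀ {A : Set} → (A → ℕ) → List A → ℕ → ℕ
countBy h xs j = length (filter (λ x → h x ≟ j) xs)

δ : ℕ → ℕ → ℕ
δ a j = indicator (does (a ≟ j))

countBy-∷ : ∀ {A : Set} (h : A → ℕ) x xs j → countBy h (x ∷ xs) j ≡ δ (h x) j ℕ.+ countBy h xs j
countBy-∷ h x xs j with does (h x ≟ j)
... | true  = refl
... | false = refl

-- hscPoly d f is definitionally lincomb d f (hscBasis (d ∸ 1)).
lincomb : ℕ → (ℕ → ℕ) → (ℕ → Poly) → Poly
lincomb d c P = sumP d λ j → scale (+ c j) (P j)

lincomb-cong : ∀ d {c c'} P → (∀ j → c j ≡ c' j) → lincomb d c P ≈ lincomb d c' P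
lincomb-cong zero    P e = ≈-refl
lincomb-cong (suc d) P e = ⊕-cong (lincomb-cong d P e) (scale-congˡ (P d) (cong +_ (e d)))

lincomb-zero : ∀ d P → lincomb d (λ _ → 0) P ≈ []
lincomb-zero zero    P = ≈-refl
lincomb-zero (suc d) P = ⊕-cong (lincomb-zero d P) (scale-zero (P d))

lincomb-+ : ∀ d a b P → lincomb d (λ j → a j ℕ.+ b j) P ≈ lincomb d a P ⊕ lincomb d b P
lincomb-+ zero    a b P = ≈-refl
lincomb-+ (suc d) a b P = begin
  lincomb d (λ j → a j ℕ.+ b j) P ⊕ scale (+ (a d ℕ.+ b d)) (P d)
    ≈⟨ ⊕-cong (lincomb-+ d a b P) (scale-congˡ (P d) (ℤP.pos-+ (a d) (b d))) ⟩
  (lincomb d a P ⊕ lincomb d b P) ⊕ scale (+ a d ℤ.+ + b d) (P d)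
    ≈⟨ ⊕-congˡ (lincomb d a P ⊕ lincomb d b P) (scale-distribʳ-+ (+ a d) (+ b d) (P d)) ⟩
  (lincomb d a P ⊕ lincomb d b P) ⊕ (scale (+ a d) (P d) ⊕ scale (+ b d) (P d))
    ≈⟨ ⊕-interchange (lincomb d a P) (lincomb d b P) _ _ ⟩
  lincomb (suc d) a P ⊕ lincomb (suc d) b P ∎
  where open ≈-Reasoning

lincomb-δ-≥ : ∀ d a P → d ℕ.≤ a → lincomb d (δ a) P ≈ []
lincomb-δ-≥ zero    a P d≤a = ≈-refl
lincomb-δ-≥ (suc d) a P d<a rewrite dec-false (a ≟ d) (ℕP.>⇒≢ d<a) =
  ⊕-cong (lincomb-δ-≥ d a P (ℕP.<⇒≤ d<a)) (scale-zero (P d))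

lincomb-δ-< : ∀ d a P → a ℕ.< d → lincomb d (δ a) P ≈ P a
lincomb-δ-< (suc d) a P a<1+d with ℕP.m≤n⇒m<n∨m≡n (ℕP.≤-pred a<1+d)
... | inj₁ a<d rewrite dec-false (a ≟ d) (ℕP.<⇒≢ a<d) =
  ≈-trans (⊕-cong (lincomb-δ-< d a P a<d) (scale-zero (P d))) (⊕-identityʳ (P a))
... | inj₂ refl rewrite dec-true (a ≟ a) refl =
  ⊕-cong (lincomb-δ-≥ a a P ℕP.≤-refl) (scale-identity (P a))

lincomb-countBy : ∀ {A : Set} d P (h : A → ℕ) xs → (∀ {x} → x ∈ xs → h x ℕ.< d) →
                  lincomb d (countBy h xs) P ≈ ΣP xs (λ x → P (h x))
lincomb-countBy d P h []       h< = lincomb-zero d P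
lincomb-countBy d P h (x ∷ xs) h< = begin
  lincomb d (countBy h (x ∷ xs)) P
    ≈⟨ lincomb-cong d P (countBy-∷ h x xs) ⟩
  lincomb d (λ j → δ (h x) j ℕ.+ countBy h xs j) P
    ≈⟨ lincomb-+ d (δ (h x)) (countBy h xs) P ⟩
  lincomb d (δ (h x)) P ⊕ lincomb d (countBy h xs) P
    ≈⟨ ⊕-cong (lincomb-δ-< d (h x) P (h< (here refl))) (lincomb-countBy d P h xs (λ x∈ → h< (there x∈))) ⟩
  P (h x) ⊕ ΣP xs (λ x → P (h x)) ∎
  where open ≈-Reasoning

lincomb-Σℕ : ∀ {A : Set} d P (c : A → ℕ → ℕ) xs →
             lincomb d (λ j → Σℕ xs (λ x → c x j)) P ≈ ΣP xs (λ x → lincomb d (c x) P)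
lincomb-Σℕ d P c []       = lincomb-zero d P
lincomb-Σℕ d P c (x ∷ xs) =
  ≈-trans (lincomb-+ d (c x) (λ j → Σℕ xs (λ y → c y j)) P)
          (⊕-congˡ (lincomb d (c x) P) (lincomb-Σℕ d P c xs))

-- The substitution x ↦ (1+3x)/(3+x)

2x 1-x 1+3x 3+x : Poly
2x   = + 0 ∷ + 2 ∷ []
1-x  = + 1 ∷ ℤ.- (+ 1) ∷ []
1+3x = + 1 ∷ + 3 ∷ []
3+x  = + 3 ∷ + 1 ∷ []

Deg≤1-2x : Deg≤ 1 2x
Deg≤1-2x (suc zero)    (s≤s ())
Deg≤1-2x (suc (suc k)) _ = refl

Deg≤1-1-x : Deg≤ 1 1-x
Deg≤1-1-x (suc zero)    (s≤s ())
Deg≤1-1-x (suc (suc k)) _ = refl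

hscBasis : ℕ → ℕ → Poly
hscBasis n j = (2x ^^ j) ⊗ (1-x ^^ (n ∸ j))

sdBasis : ℕ → ℕ → Poly
sdBasis n m = (1+3x ^^ m) ⊗ (1-x ^^ (n ∸ m))

-- möbius n p = (3+x)ⁿ · p((1+3x)/(3+x)) as long as deg p ≤ n.
möbius : ℕ → Poly → Poly
möbius n []      = []
möbius n (a ∷ p) = scale a (3+x ^^ n) ⊕ (1+3x ⊗ möbius (n ∸ 1) p)

möbius-≈[] : ∀ n {p} → p ≈ [] → möbius n p ≈ []
möbius-≈[] n {[]}    e = ≈-refl
möbius-≈[] n {a ∷ p} e = begin
  scale a (3+x ^^ n) ⊕ (1+3x ⊗ möbius (n ∸ 1) p)
    ≈⟨ ⊕-cong (scale-congˡ (3+x ^^ n) (coeff-≡ e 0))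
              (⊗-congʳ 1+3x (möbius-≈[] (n ∸ 1) (∷-≈-tail e))) ⟩
  scale +0 (3+x ^^ n) ⊕ (1+3x ⊗ [])
    ≈⟨ ⊕-cong (scale-zero (3+x ^^ n)) (⊗-zeroʳ 1+3x) ⟩
  [] ∎
  where open ≈-Reasoning

möbius-cong : ∀ n {p q} → p ≈ q → möbius n p ≈ möbius n q
möbius-cong n {[]}    {[]}    e = ≈-refl
möbius-cong n {[]}    {b ∷ q} e = ≈-sym (möbius-≈[] n (≈-sym e))
möbius-cong n {a ∷ p} {[]}    e = möbius-≈[] n e
möbius-cong n {a ∷ p} {b ∷ q} e =
  ⊕-cong (scale-congˡ (3+x ^^ n) (coeff-≡ e 0)) (⊗-congʳ 1+3x (möbius-cong (n ∸ 1) (∷-≈-tail e)))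

möbius-⊕ : ∀ n p q → möbius n (p ⊕ q) ≈ möbius n p ⊕ möbius n q
möbius-⊕ n []      q       = ≈-refl
möbius-⊕ n (a ∷ p) []      = ≈-sym (⊕-identityʳ (möbius n (a ∷ p)))
möbius-⊕ n (a ∷ p) (b ∷ q) = begin
  scale (a ℤ.+ b) V ⊕ (1+3x ⊗ möbius (n ∸ 1) (p ⊕ q))
    ≈⟨ ⊕-cong (scale-distribʳ-+ a b V) (⊗-congʳ 1+3x (möbius-⊕ (n ∸ 1) p q)) ⟩
  (scale a V ⊕ scale b V) ⊕ (1+3x ⊗ (möbius (n ∸ 1) p ⊕ möbius (n ∸ 1) q))
    ≈⟨ ⊕-congˡ (scale a V ⊕ scale b V) (⊗-distribˡ 1+3x (möbius (n ∸ 1) p) (möbius (n ∸ 1) q)) ⟩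
  (scale a V ⊕ scale b V) ⊕ ((1+3x ⊗ möbius (n ∸ 1) p) ⊕ (1+3x ⊗ möbius (n ∸ 1) q))
    ≈⟨ ⊕-interchange (scale a V) (scale b V) _ _ ⟩
  (scale a V ⊕ (1+3x ⊗ möbius (n ∸ 1) p)) ⊕ (scale b V ⊕ (1+3x ⊗ möbius (n ∸ 1) q)) ∎
  where
  open ≈-Reasoning
  V = 3+x ^^ n

möbius-scale : ∀ n c p → möbius n (scale c p) ≈ scale c (möbius n p)
möbius-scale n c []      = ≈-refl
möbius-scale n c (a ∷ p) = begin
  scale (c ℤ.* a) V ⊕ (1+3x ⊗ möbius (n ∸ 1) (scale c p))
    ≈⟨ ⊕-cong (≈-sym (scale-assoc c a V)) (⊗-congʳ 1+3x (möbius-scale (n ∸ 1) c p)) ⟩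
  scale c (scale a V) ⊕ (1+3x ⊗ scale c (möbius (n ∸ 1) p))
    ≈⟨ ⊕-congˡ (scale c (scale a V)) (⊗-scaleʳ c 1+3x _) ⟩
  scale c (scale a V) ⊕ scale c (1+3x ⊗ möbius (n ∸ 1) p)
    ≈⟨ scale-distribˡ-⊕ c (scale a V) _ ⟨
  scale c (scale a V ⊕ (1+3x ⊗ möbius (n ∸ 1) p)) ∎
  where
  open ≈-Reasoning
  V = 3+x ^^ n

möbius-ΣP : ∀ {A : Set} n (xs : List A) g → möbius n (ΣP xs g) ≈ ΣP xs (λ x → möbius n (g x))
möbius-ΣP n []       g = ≈-refl
möbius-ΣP n (x ∷ xs) g =
  ≈-trans (möbius-⊕ n (g x) (ΣP xs g)) (⊕-congˡ (möbius n (g x)) (möbius-ΣP n xs g))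

möbius-0∷ : ∀ n p → möbius (suc n) (+0 ∷ p) ≈ 1+3x ⊗ möbius n p
möbius-0∷ n p = ⊕-congʳ (1+3x ⊗ möbius n p) (scale-zero (3+x ^^ suc n))

möbius-suc : ∀ n p → Deg≤ n p → möbius (suc n) p ≈ 3+x ⊗ möbius n p
möbius-suc n []      D = ≈-sym (⊗-zeroʳ 3+x)
möbius-suc n (a ∷ p) D = begin
  scale a (3+x ⊗ V) ⊕ (1+3x ⊗ möbius n p)
    ≈⟨ ⊕-congˡ (scale a (3+x ⊗ V)) (tail-step n D) ⟩
  scale a (3+x ⊗ V) ⊕ (3+x ⊗ (1+3x ⊗ möbius (n ∸ 1) p))
    ≈⟨ ⊕-congʳ (3+x ⊗ (1+3x ⊗ möbius (n ∸ 1) p)) (⊗-scaleʳ a 3+x V) ⟨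
  (3+x ⊗ scale a V) ⊕ (3+x ⊗ (1+3x ⊗ möbius (n ∸ 1) p))
    ≈⟨ ⊗-distribˡ 3+x (scale a V) _ ⟨
  3+x ⊗ (scale a V ⊕ (1+3x ⊗ möbius (n ∸ 1) p)) ∎
  where
  open ≈-Reasoning
  V = 3+x ^^ n
  tail-step : ∀ n → Deg≤ n (a ∷ p) → 1+3x ⊗ möbius n p ≈ 3+x ⊗ (1+3x ⊗ möbius (n ∸ 1) p)
  tail-step zero D = ≈-trans vanishes (≈-sym (≈-trans (⊗-congʳ 3+x vanishes) (⊗-zeroʳ 3+x)))
    where
    vanishes : 1+3x ⊗ möbius 0 p ≈ []
    vanishes = ≈-trans (⊗-congʳ 1+3x (möbius-≈[] 0 (Deg≤0-tail D))) (⊗-zeroʳ 1+3x)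
  tail-step (suc n) D =
    ≈-trans (⊗-congʳ 1+3x (möbius-suc n p (Deg≤-tail n D))) (x⊗yz≈y⊗xz 1+3x 3+x (möbius n p))

⊕-0∷[] : ∀ p → p ⊕ (+0 ∷ []) ≈ p
⊕-0∷[] p = ≈-trans (⊕-congˡ p (0∷-≈[] ≈-refl)) (⊕-identityʳ p)

2x⊗-expand : ∀ s → 2x ⊗ s ≈ +0 ∷ scale (+ 2) s
2x⊗-expand s = ≈-trans (⊕-congʳ (+0 ∷ (scale (+ 2) s ⊕ (+0 ∷ []))) (scale-zero s))
                       (∷-cong refl (⊕-0∷[] (scale (+ 2) s)))

1-x⊗-expand : ∀ s → 1-x ⊗ s ≈ s ⊕ (+0 ∷ scale -1ℤ s)
1-x⊗-expand s = ⊕-cong (scale-identity s) (∷-cong refl (⊕-0∷[] (scale -1ℤ s)))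

möbius-2x⊗ : ∀ n s → möbius (suc n) (2x ⊗ s) ≈ scale (+ 2) (1+3x ⊗ möbius n s)
möbius-2x⊗ n s = begin
  möbius (suc n) (2x ⊗ s)                 ≈⟨ möbius-cong (suc n) (2x⊗-expand s) ⟩
  möbius (suc n) (+0 ∷ scale (+ 2) s)     ≈⟨ möbius-0∷ n (scale (+ 2) s) ⟩
  1+3x ⊗ möbius n (scale (+ 2) s)         ≈⟨ ⊗-congʳ 1+3x (möbius-scale n (+ 2) s) ⟩
  1+3x ⊗ scale (+ 2) (möbius n s)         ≈⟨ ⊗-scaleʳ (+ 2) 1+3x (möbius n s) ⟩
  scale (+ 2) (1+3x ⊗ möbius n s)         ∎
  where open ≈-Reasoning

-- The substitution sends 1-x to (3+x) - (1+3x) = 2(1-x).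
möbius-1-x⊗ : ∀ n s → Deg≤ n s → möbius (suc n) (1-x ⊗ s) ≈ scale (+ 2) (1-x ⊗ möbius n s)
möbius-1-x⊗ n s D = begin
  möbius (suc n) (1-x ⊗ s)
    ≈⟨ möbius-cong (suc n) (1-x⊗-expand s) ⟩
  möbius (suc n) (s ⊕ (+0 ∷ scale -1ℤ s))
    ≈⟨ möbius-⊕ (suc n) s (+0 ∷ scale -1ℤ s) ⟩
  möbius (suc n) s ⊕ möbius (suc n) (+0 ∷ scale -1ℤ s)
    ≈⟨ ⊕-cong (möbius-suc n s D) (möbius-0∷ n (scale -1ℤ s)) ⟩
  (3+x ⊗ M) ⊕ (1+3x ⊗ möbius n (scale -1ℤ s))
    ≈⟨ ⊕-congˡ (3+x ⊗ M) (⊗-congʳ 1+3x (möbius-scale n -1ℤ s)) ⟩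
  (3+x ⊗ M) ⊕ (1+3x ⊗ scale -1ℤ M)
    ≈⟨ ⊕-congˡ (3+x ⊗ M) (⊗-scaleʳ -1ℤ 1+3x M) ⟩
  (3+x ⊗ M) ⊕ scale -1ℤ (1+3x ⊗ M)
    ≈⟨ ⊕-congˡ (3+x ⊗ M) (⊗-scaleˡ -1ℤ 1+3x M) ⟨
  (3+x ⊗ M) ⊕ (scale -1ℤ 1+3x ⊗ M)
    ≈⟨ ⊗-distribʳ 3+x (scale -1ℤ 1+3x) M ⟨
  (3+x ⊕ scale -1ℤ 1+3x) ⊗ M
    ≡⟨⟩
  scale (+ 2) 1-x ⊗ M
    ≈⟨ ⊗-scaleˡ (+ 2) 1-x M ⟩
  scale (+ 2) (1-x ⊗ M) ∎
  where
  open ≈-Reasoning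
  M = möbius n s

+2^suc : ∀ n → + (2 ^ suc n) ≡ + 2 ℤ.* + (2 ^ n)
+2^suc n = ℤP.pos-* 2 (2 ^ n)

möbius-1-x^^ : ∀ b → möbius b (1-x ^^ b) ≈ scale (+ (2 ^ b)) (1-x ^^ b)
möbius-1-x^^ zero    = mk≈ λ { zero → refl ; (suc zero) → refl ; (suc (suc k)) → refl }
möbius-1-x^^ (suc b) = begin
  möbius (suc b) (1-x ⊗ Y)                      ≈⟨ möbius-1-x⊗ b Y (Deg≤-^^ 1-x b Deg≤1-1-x) ⟩
  scale (+ 2) (1-x ⊗ möbius b Y)                ≈⟨ scale-congʳ (+ 2) (⊗-congʳ 1-x (möbius-1-x^^ b)) ⟩
  scale (+ 2) (1-x ⊗ scale (+ (2 ^ b)) Y)       ≈⟨ scale-congʳ (+ 2) (⊗-scaleʳ (+ (2 ^ b)) 1-x Y) ⟩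
  scale (+ 2) (scale (+ (2 ^ b)) (1-x ⊗ Y))     ≈⟨ scale-assoc (+ 2) (+ (2 ^ b)) (1-x ⊗ Y) ⟩
  scale (+ 2 ℤ.* + (2 ^ b)) (1-x ⊗ Y)           ≈⟨ scale-congˡ (1-x ⊗ Y) (+2^suc b) ⟨
  scale (+ (2 ^ suc b)) (1-x ⊗ Y)               ∎
  where
  open ≈-Reasoning
  Y = 1-x ^^ b

möbius-2x^^⊗1-x^^ : ∀ a b → möbius (a ℕ.+ b) ((2x ^^ a) ⊗ (1-x ^^ b)) ≈
                            scale (+ (2 ^ (a ℕ.+ b))) ((1+3x ^^ a) ⊗ (1-x ^^ b))
möbius-2x^^⊗1-x^^ zero b = begin
  möbius b ((+ 1 ∷ []) ⊗ Y)           ≈⟨ möbius-cong b (⊗-identityˡ Y) ⟩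
  möbius b Y                          ≈⟨ möbius-1-x^^ b ⟩
  scale (+ (2 ^ b)) Y                 ≈⟨ scale-congʳ (+ (2 ^ b)) (⊗-identityˡ Y) ⟨
  scale (+ (2 ^ b)) ((+ 1 ∷ []) ⊗ Y)  ∎
  where
  open ≈-Reasoning
  Y = 1-x ^^ b
möbius-2x^^⊗1-x^^ (suc a) b = begin
  möbius (suc (a ℕ.+ b)) ((2x ⊗ (2x ^^ a)) ⊗ Y)
    ≈⟨ möbius-cong (suc (a ℕ.+ b)) (⊗-assoc 2x (2x ^^ a) Y) ⟩
  möbius (suc (a ℕ.+ b)) (2x ⊗ ((2x ^^ a) ⊗ Y))
    ≈⟨ möbius-2x⊗ (a ℕ.+ b) ((2x ^^ a) ⊗ Y) ⟩
  scale (+ 2) (1+3x ⊗ möbius (a ℕ.+ b) ((2x ^^ a) ⊗ Y))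
    ≈⟨ scale-congʳ (+ 2) (⊗-congʳ 1+3x (möbius-2x^^⊗1-x^^ a b)) ⟩
  scale (+ 2) (1+3x ⊗ scale c W)
    ≈⟨ scale-congʳ (+ 2) (⊗-scaleʳ c 1+3x W) ⟩
  scale (+ 2) (scale c (1+3x ⊗ W))
    ≈⟨ scale-assoc (+ 2) c (1+3x ⊗ W) ⟩
  scale (+ 2 ℤ.* c) (1+3x ⊗ W)
    ≈⟨ scale-cong (sym (+2^suc (a ℕ.+ b))) (≈-sym (⊗-assoc 1+3x (1+3x ^^ a) Y)) ⟩
  scale (+ (2 ^ suc (a ℕ.+ b))) ((1+3x ⊗ (1+3x ^^ a)) ⊗ Y) ∎
  where
  open ≈-Reasoning
  Y = 1-x ^^ b
  c = + (2 ^ (a ℕ.+ b))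
  W = (1+3x ^^ a) ⊗ Y

möbius-hscBasis : ∀ n j → j ℕ.≤ n → möbius n (hscBasis n j) ≈ scale (+ (2 ^ n)) (sdBasis n j)
möbius-hscBasis n j j≤n =
  subst (λ k → möbius k (hscBasis n j) ≈ scale (+ (2 ^ k)) (sdBasis n j))
        (ℕP.m+[n∸m]≡n j≤n) (möbius-2x^^⊗1-x^^ j (n ∸ j))

Deg≤-hscBasis : ∀ n j → j ℕ.≤ n → Deg≤ n (hscBasis n j)
Deg≤-hscBasis n j j≤n = subst (λ k → Deg≤ k (hscBasis n j)) (ℕP.m+[n∸m]≡n j≤n)
  (Deg≤-⊗ j (n ∸ j) (2x ^^ j) (1-x ^^ (n ∸ j)) (Deg≤-^^ 2x j Deg≤1-2x) (Deg≤-^^ 1-x (n ∸ j) Deg≤1-1-x))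

NonnegCoeffs-möbius : ∀ n p → NonnegCoeffs p → NonnegCoeffs (möbius n p)
NonnegCoeffs-möbius n []      N = NonnegCoeffs-[]
NonnegCoeffs-möbius n (a ∷ p) N =
  NonnegCoeffs-⊕ (scale a (3+x ^^ n)) (1+3x ⊗ möbius (n ∸ 1) p)
    (NonnegCoeffs-scale a (3+x ^^ n) (N 0) (NonnegCoeffs-^^ 3+x n (nonnegCoeffs₂ 3 1)))
    (NonnegCoeffs-⊗ 1+3x (möbius (n ∸ 1) p) (nonnegCoeffs₂ 1 3)
                    (NonnegCoeffs-möbius (n ∸ 1) p (λ i → N (suc i))))
  where
  nonnegCoeffs₂ : ∀ a b → NonnegCoeffs (+ a ∷ + b ∷ [])
  nonnegCoeffs₂ a b = NonnegCoeffs-∷ (+ a) _ (+≤+ z≤n) (NonnegCoeffs-∷ (+ b) [] (+≤+ z≤n) NonnegCoeffs-[])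

-- Faces of the standard cube

cubeFaces : ∀ m → List (CubeFace m)
cubeFaces zero    = [] ∷ []
cubeFaces (suc m) = map (nothing ∷_) (cubeFaces m) ++
                    (map (just false ∷_) (cubeFaces m) ++ map (just true ∷_) (cubeFaces m))

codim : ∀ {m} → CubeFace m → ℕ
codim []            = 0
codim (nothing ∷ q) = codim q
codim (just _ ∷ q)  = suc (codim q)

codim-≤ : ∀ {m} (q : CubeFace m) → codim q ℕ.≤ m
codim-≤ []            = z≤n
codim-≤ (nothing ∷ q) = ℕP.m≤n⇒m≤1+n (codim-≤ q)
codim-≤ (just _ ∷ q)  = s≤s (codim-≤ q)

faceDim : ∀ {m} → CubeFace m → ℕ
faceDim []            = 0
faceDim (nothing ∷ q) = suc (faceDim q)
faceDim (just _ ∷ q)  = faceDim q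

faceDim+codim : ∀ {m} (q : CubeFace m) → faceDim q ℕ.+ codim q ≡ m
faceDim+codim []            = refl
faceDim+codim (nothing ∷ q) = cong suc (faceDim+codim q)
faceDim+codim (just _ ∷ q)  = trans (ℕP.+-suc (faceDim q) (codim q)) (cong suc (faceDim+codim q))

fullFace : ∀ m → CubeFace m
fullFace m = V.replicate m nothing

faceDim-fullFace : ∀ m → faceDim (fullFace m) ≡ m
faceDim-fullFace zero    = refl
faceDim-fullFace (suc m) = cong suc (faceDim-fullFace m)

∈-fullFace : ∀ {m} (c : Vec Bool m) → T (inCubeFace (fullFace m) c)
∈-fullFace []      = _
∈-fullFace (b ∷ c) = ∈-fullFace c

head-∈-map-∷ : ∀ {A : Set} {m} {x : A} {xs : List (Vec A m)} {v} → v ∈ map (x ∷_) xs → V.head v ≡ x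
head-∈-map-∷ v∈ with ∈-map⁻ _ v∈
... | _ , _ , refl = refl

∈-map-∷⇒head≢ : ∀ {A : Set} {m} {x y : A} {xs : List (Vec A m)} → ¬ x ≡ y →
                ∀ {v} → v ∈ map (x ∷_) xs → ¬ V.head v ≡ y
∈-map-∷⇒head≢ x≢y v∈ head≡y = x≢y (trans (sym (head-∈-map-∷ v∈)) head≡y)

Unique-map-∷ : ∀ {A : Set} {m} (x : A) {xs : List (Vec A m)} → Unique xs → Unique (map (x ∷_) xs)
Unique-map-∷ x = UniqueP.map⁺ VP.∷-injectiveʳ

Unique-map-∷-++ : ∀ {A : Set} {m} (x : A) {xs : List (Vec A m)} {ys} → Unique xs → Unique ys →
                  (∀ {v} → v ∈ ys → ¬ V.head v ≡ x) → Unique (map (x ∷_) xs ++ ys)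
Unique-map-∷-++ x ux uy head≢x =
  UniqueP.++⁺ (Unique-map-∷ x ux) uy (λ (v∈xs , v∈ys) → head≢x v∈ys (head-∈-map-∷ v∈xs))

∈-cubeVertices : ∀ {m} (c : Vec Bool m) → c ∈ cubeVertices m
∈-cubeVertices []          = here refl
∈-cubeVertices (false ∷ c) = ∈-++⁺ˡ (∈-map⁺ (false ∷_) (∈-cubeVertices c))
∈-cubeVertices (true ∷ c)  = ∈-++⁺ʳ (map (false ∷_) _) (∈-map⁺ (true ∷_) (∈-cubeVertices c))

cubeVertices-unique : ∀ m → Unique (cubeVertices m)
cubeVertices-unique zero    = [] ∷ []
cubeVertices-unique (suc m) =
  Unique-map-∷-++ false u (Unique-map-∷ true u) (∈-map-∷⇒head≢ λ ())
  where u = cubeVertices-unique m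

∈-cubeFaces : ∀ {m} (q : CubeFace m) → q ∈ cubeFaces m
∈-cubeFaces []                       = here refl
∈-cubeFaces         (nothing ∷ q)    = ∈-++⁺ˡ (∈-map⁺ (nothing ∷_) (∈-cubeFaces q))
∈-cubeFaces {suc m} (just false ∷ q) =
  ∈-++⁺ʳ (map (nothing ∷_) (cubeFaces m)) (∈-++⁺ˡ (∈-map⁺ (just false ∷_) (∈-cubeFaces q)))
∈-cubeFaces {suc m} (just true ∷ q)  =
  ∈-++⁺ʳ (map (nothing ∷_) (cubeFaces m))
         (∈-++⁺ʳ (map (just false ∷_) (cubeFaces m)) (∈-map⁺ (just true ∷_) (∈-cubeFaces q)))

cubeFaces-unique : ∀ m → Unique (cubeFaces m)
cubeFaces-unique zero    = [] ∷ []
cubeFaces-unique (suc m) =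
  Unique-map-∷-++ nothing u
    (Unique-map-∷-++ (just false) u (Unique-map-∷ (just true) u) (∈-map-∷⇒head≢ λ ()))
    (λ v∈ → [ ∈-map-∷⇒head≢ (λ ()) , ∈-map-∷⇒head≢ (λ ()) ]′ (∈-++⁻ (map (just false ∷_) Q) v∈))
  where
  Q = cubeFaces m
  u = cubeFaces-unique m

faceVertices : ∀ {m} → CubeFace m → List (Vec Bool m)
faceVertices {m} q = filterᵇ (inCubeFace q) (cubeVertices m)

length-faceVertices : ∀ {m} (q : CubeFace m) → length (faceVertices q) ≡ 2 ^ faceDim q
length-faceVertices [] = refl
length-faceVertices {suc m} (x ∷ q) = begin
  length (faceVertices (x ∷ q))
    ≡⟨ length-filterᵇ (inCubeFace (x ∷ q)) (cubeVertices (suc m)) ⟩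
  Σℕ (map (false ∷_) Q ++ map (true ∷_) Q) g
    ≡⟨ Σℕ-++ (map (false ∷_) Q) (map (true ∷_) Q) g ⟩
  Σℕ (map (false ∷_) Q) g ℕ.+ Σℕ (map (true ∷_) Q) g
    ≡⟨ cong₂ ℕ._+_ (Σℕ-map (false ∷_) Q g) (Σℕ-map (true ∷_) Q g) ⟩
  Σℕ Q (λ c → g (false ∷ c)) ℕ.+ Σℕ Q (λ c → g (true ∷ c))
    ≡⟨ split x ⟩
  2 ^ faceDim (x ∷ q) ∎
  where
  open ≡-Reasoning
  Q = cubeVertices m
  g : Vec Bool (suc m) → ℕ
  g c = indicator (inCubeFace (x ∷ q) c)
  count-q : Σℕ Q (λ c → indicator (inCubeFace q c)) ≡ 2 ^ faceDim q
  count-q = trans (sym (length-filterᵇ (inCubeFace q) Q)) (length-faceVertices q)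
  split : ∀ x → Σℕ Q (λ c → indicator (inCubeFace (x ∷ q) (false ∷ c))) ℕ.+
                Σℕ Q (λ c → indicator (inCubeFace (x ∷ q) (true ∷ c))) ≡ 2 ^ faceDim (x ∷ q)
  split nothing      = cong₂ ℕ._+_ count-q (trans count-q (sym (ℕP.+-identityʳ _)))
  split (just false) = trans (cong₂ ℕ._+_ count-q (Σℕ-zero Q)) (ℕP.+-identityʳ _)
  split (just true)  = cong₂ ℕ._+_ (Σℕ-zero Q) count-q

inCoordinate : Maybe Bool → Bool → Bool
inCoordinate nothing   b = true
inCoordinate (just b₀) b = if b₀ then b else not b

inCubeFace-∷ : ∀ {m} x (q : CubeFace m) b c → inCubeFace (x ∷ q) (b ∷ c) ≡ inCoordinate x b ∧ inCubeFace q c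
inCubeFace-∷ nothing  q b c = refl
inCubeFace-∷ (just _) q b c = refl

decodeCoordinate : Bool → Bool → Maybe Bool
decodeCoordinate true  true  = nothing
decodeCoordinate false true  = just true
decodeCoordinate true  false = just false
decodeCoordinate false false = nothing

decodeCoordinate-inCoordinate : ∀ x → decodeCoordinate (inCoordinate x false) (inCoordinate x true) ≡ x
decodeCoordinate-inCoordinate nothing      = refl
decodeCoordinate-inCoordinate (just true)  = refl
decodeCoordinate-inCoordinate (just false) = refl

inCoordinate-injective : ∀ x y → (∀ b → inCoordinate x b ≡ inCoordinate y b) → x ≡ y
inCoordinate-injective x y e = begin
  x                                                              ≡⟨ decodeCoordinate-inCoordinate x ⟨
  decodeCoordinate (inCoordinate x false) (inCoordinate x true)  ≡⟨ cong₂ decodeCoordinate (e false) (e true) ⟩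
  decodeCoordinate (inCoordinate y false) (inCoordinate y true)  ≡⟨ decodeCoordinate-inCoordinate y ⟩
  y                                                              ∎
  where open ≡-Reasoning

corner : Maybe Bool → Bool
corner nothing  = false
corner (just b) = b

inCoordinate-corner : ∀ x → inCoordinate x (corner x) ≡ true
inCoordinate-corner nothing      = refl
inCoordinate-corner (just true)  = refl
inCoordinate-corner (just false) = refl

inCubeFace-corner : ∀ {m} (q : CubeFace m) → inCubeFace q (V.map corner q) ≡ true
inCubeFace-corner []      = refl
inCubeFace-corner (x ∷ q) =
  trans (inCubeFace-∷ x q (corner x) _) (cong₂ _∧_ (inCoordinate-corner x) (inCubeFace-corner q))

∧≡true⇒ʳ : ∀ {a b} → a ∧ b ≡ true → b ≡ true
∧≡true⇒ʳ {true} e = e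

inCubeFace-injective : ∀ {m} (q q' : CubeFace m) → (∀ c → inCubeFace q c ≡ inCubeFace q' c) → q ≡ q'
inCubeFace-injective []      []        e = refl
inCubeFace-injective (x ∷ q) (y ∷ q') e = cong₂ _∷_ x≡y (inCubeFace-injective q q' tail≡)
  where
  e∷ : ∀ b c → inCoordinate x b ∧ inCubeFace q c ≡ inCoordinate y b ∧ inCubeFace q' c
  e∷ b c = trans (sym (inCubeFace-∷ x q b c)) (trans (e (b ∷ c)) (inCubeFace-∷ y q' b c))
  qCorner = V.map corner q
  qCorner∈q' : inCubeFace q' qCorner ≡ true
  qCorner∈q' = ∧≡true⇒ʳ (trans (sym (e∷ (corner x) qCorner))
                               (cong₂ _∧_ (inCoordinate-corner x) (inCubeFace-corner q)))
  head≡ : ∀ b → inCoordinate x b ≡ inCoordinate y b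
  head≡ b = begin
    inCoordinate x b                           ≡⟨ BP.∧-identityʳ _ ⟨
    inCoordinate x b ∧ true                    ≡⟨ cong (inCoordinate x b ∧_) (inCubeFace-corner q) ⟨
    inCoordinate x b ∧ inCubeFace q qCorner    ≡⟨ e∷ b qCorner ⟩
    inCoordinate y b ∧ inCubeFace q' qCorner   ≡⟨ cong (inCoordinate y b ∧_) qCorner∈q' ⟩
    inCoordinate y b ∧ true                    ≡⟨ BP.∧-identityʳ _ ⟩
    inCoordinate y b                           ∎
    where open ≡-Reasoning
  x≡y = inCoordinate-injective x y head≡
  tail≡ : ∀ c → inCubeFace q c ≡ inCubeFace q' c
  tail≡ c = begin
    inCubeFace q c
      ≡⟨⟩
    true ∧ inCubeFace q c
      ≡⟨ cong (_∧ inCubeFace q c) (inCoordinate-corner x) ⟨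
    inCoordinate x (corner x) ∧ inCubeFace q c
      ≡⟨ e∷ (corner x) c ⟩
    inCoordinate y (corner x) ∧ inCubeFace q' c
      ≡⟨ cong (_∧ inCubeFace q' c) (trans (sym (head≡ (corner x))) (inCoordinate-corner x)) ⟩
    true ∧ inCubeFace q' c
      ≡⟨⟩
    inCubeFace q' c ∎
    where open ≡-Reasoning

hscBasis-suc : ∀ n k → k ℕ.≤ n → hscBasis (suc n) k ≈ 1-x ⊗ hscBasis n k
hscBasis-suc n k k≤n rewrite ℕP.+-∸-assoc 1 k≤n = x⊗yz≈y⊗xz (2x ^^ k) 1-x (1-x ^^ (n ∸ k))

hscBasis-suc-suc : ∀ n k → hscBasis (suc n) (suc k) ≈ 2x ⊗ hscBasis n k
hscBasis-suc-suc n k = ⊗-assoc 2x (2x ^^ k) (1-x ^^ (n ∸ k))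

ΣP-cubeFaces-suc : ∀ m g → ΣP (cubeFaces (suc m)) g ≈
  ΣP (cubeFaces m) (λ q → g (nothing ∷ q)) ⊕
  (ΣP (cubeFaces m) (λ q → g (just false ∷ q)) ⊕ ΣP (cubeFaces m) (λ q → g (just true ∷ q)))
ΣP-cubeFaces-suc m g = begin
  ΣP (F₀ ++ (F₁ ++ F₂)) g            ≈⟨ ΣP-++ F₀ (F₁ ++ F₂) g ⟩
  ΣP F₀ g ⊕ ΣP (F₁ ++ F₂) g          ≈⟨ ⊕-congˡ (ΣP F₀ g) (ΣP-++ F₁ F₂ g) ⟩
  ΣP F₀ g ⊕ (ΣP F₁ g ⊕ ΣP F₂ g)      ≡⟨ cong₂ _⊕_ (ΣP-map (nothing ∷_) Q g)
                                          (cong₂ _⊕_ (ΣP-map (just false ∷_) Q g) (ΣP-map (just true ∷_) Q g)) ⟩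
  _                                  ∎
  where
  open ≈-Reasoning
  Q  = cubeFaces m
  F₀ = map (nothing ∷_) Q
  F₁ = map (just false ∷_) Q
  F₂ = map (just true ∷_) Q

-- A free coordinate contributes a factor 1-x and each of its two fixed values a factor 2x,
-- and (1-x) + 2x + 2x = 1+3x.
ΣP-cubeFaces-hscBasis : ∀ m n → m ℕ.≤ n → ΣP (cubeFaces m) (λ q → hscBasis n (codim q)) ≈ sdBasis n m
ΣP-cubeFaces-hscBasis zero    n       _        = ⊕-identityʳ (hscBasis n 0)
ΣP-cubeFaces-hscBasis (suc m) (suc n) (s≤s m≤n) = begin
  ΣP (cubeFaces (suc m)) (λ q → hscBasis (suc n) (codim q))
    ≈⟨ ΣP-cubeFaces-suc m (λ q → hscBasis (suc n) (codim q)) ⟩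
  ΣP Q (λ q → hscBasis (suc n) (codim q)) ⊕
  (ΣP Q (λ q → hscBasis (suc n) (suc (codim q))) ⊕ ΣP Q (λ q → hscBasis (suc n) (suc (codim q))))
    ≈⟨ ⊕-cong (ΣP-cong Q (λ {q} _ → hscBasis-suc n (codim q) (ℕP.≤-trans (codim-≤ q) m≤n)))
              (⊕-cong (ΣP-cong Q (λ {q} _ → hscBasis-suc-suc n (codim q)))
                      (ΣP-cong Q (λ {q} _ → hscBasis-suc-suc n (codim q)))) ⟩
  ΣP Q (λ q → 1-x ⊗ B q) ⊕ (ΣP Q (λ q → 2x ⊗ B q) ⊕ ΣP Q (λ q → 2x ⊗ B q))
    ≈⟨ ⊕-cong (⊗-ΣP 1-x Q B) (⊕-cong (⊗-ΣP 2x Q B) (⊗-ΣP 2x Q B)) ⟨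
  (1-x ⊗ S) ⊕ ((2x ⊗ S) ⊕ (2x ⊗ S))
    ≈⟨ ⊕-congˡ (1-x ⊗ S) (⊗-distribʳ 2x 2x S) ⟨
  (1-x ⊗ S) ⊕ ((2x ⊕ 2x) ⊗ S)
    ≈⟨ ⊗-distribʳ 1-x (2x ⊕ 2x) S ⟨
  1+3x ⊗ S
    ≈⟨ ⊗-congʳ 1+3x (ΣP-cubeFaces-hscBasis m n m≤n) ⟩
  1+3x ⊗ sdBasis n m
    ≈⟨ ⊗-assoc 1+3x (1+3x ^^ m) (1-x ^^ (n ∸ m)) ⟨
  sdBasis (suc n) (suc m) ∎
  where
  open ≈-Reasoning
  Q = cubeFaces m
  B : CubeFace m → Poly
  B q = hscBasis n (codim q)
  S = ΣP Q B

-- The h-polynomial of the face intervals of a family of cubes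

-- f_j(sd_c K) when xs lists the faces of K and h = dim.
sdCount : ∀ {A : Set} → (A → ℕ) → List A → ℕ → ℕ
sdCount h xs j = Σℕ xs (λ x → countBy codim (cubeFaces (h x)) j)

module _ {A : Set} (n : ℕ) (h : A → ℕ) (xs : List A) (h≤n : ∀ {x} → x ∈ xs → h x ℕ.≤ n) where

  hscPoly-countBy : hscPoly (suc n) (countBy h xs) ≈ ΣP xs (λ x → hscBasis n (h x))
  hscPoly-countBy = lincomb-countBy (suc n) (hscBasis n) h xs (λ x∈ → s≤s (h≤n x∈))

  hscPoly-sdCount : hscPoly (suc n) (sdCount h xs) ≈ ΣP xs (λ x → sdBasis n (h x))
  hscPoly-sdCount = begin
    hscPoly (suc n) (sdCount h xs)
      ≈⟨ lincomb-Σℕ (suc n) (hscBasis n) (λ x → countBy codim (cubeFaces (h x))) xs ⟩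
    ΣP xs (λ x → lincomb (suc n) (countBy codim (cubeFaces (h x))) (hscBasis n))
      ≈⟨ ΣP-cong xs (λ x∈ → lincomb-countBy (suc n) (hscBasis n) codim (cubeFaces _)
                              (λ {q} _ → s≤s (ℕP.≤-trans (codim-≤ q) (h≤n x∈)))) ⟩
    ΣP xs (λ x → ΣP (cubeFaces (h x)) (λ q → hscBasis n (codim q)))
      ≈⟨ ΣP-cong xs (λ x∈ → ΣP-cubeFaces-hscBasis _ n (h≤n x∈)) ⟩
    ΣP xs (λ x → sdBasis n (h x)) ∎
    where open ≈-Reasoning

  möbius-hscPoly-countBy :
    möbius n (hscPoly (suc n) (countBy h xs)) ≈ scale (+ (2 ^ n)) (hscPoly (suc n) (sdCount h xs))
  möbius-hscPoly-countBy = begin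
    möbius n (hscPoly (suc n) (countBy h xs))          ≈⟨ möbius-cong n hscPoly-countBy ⟩
    möbius n (ΣP xs (λ x → hscBasis n (h x)))          ≈⟨ möbius-ΣP n xs (λ x → hscBasis n (h x)) ⟩
    ΣP xs (λ x → möbius n (hscBasis n (h x)))          ≈⟨ ΣP-cong xs (λ x∈ → möbius-hscBasis n _ (h≤n x∈)) ⟩
    ΣP xs (λ x → scale (+ (2 ^ n)) (sdBasis n (h x)))  ≈⟨ scale-ΣP (+ (2 ^ n)) xs (λ x → sdBasis n (h x)) ⟨
    scale (+ (2 ^ n)) (ΣP xs (λ x → sdBasis n (h x)))  ≈⟨ scale-congʳ (+ (2 ^ n)) hscPoly-sdCount ⟨
    scale (+ (2 ^ n)) (hscPoly (suc n) (sdCount h xs)) ∎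
    where open ≈-Reasoning

Deg≤-hscPoly : ∀ n f → Deg≤ n (hscPoly (suc n) f)
Deg≤-hscPoly n f = Deg≤-sumP n (suc n) _
  (λ j j<1+n → Deg≤-scale {p = hscBasis n j} (+ f j) (Deg≤-hscBasis n j (ℕP.≤-pred j<1+n)))

Nonneg⇒NonnegCoeffs : ∀ n f → Nonneg (suc n) f → NonnegCoeffs (hscPoly (suc n) f)
Nonneg⇒NonnegCoeffs n f N i with i ℕ.<? suc n
... | yes i<1+n = N i i<1+n
... | no  i≮1+n = subst (+ 0 ≤_) (sym (Deg≤-hscPoly n f i (ℕP.≤-pred (ℕP.≰⇒> i≮1+n)))) (+≤+ z≤n)

NonnegCoeffs-scale⁻¹ : ∀ a .{{_ : ℤ.Positive a}} p → NonnegCoeffs (scale a p) → NonnegCoeffs p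
NonnegCoeffs-scale⁻¹ a p N i = ℤP.*-cancelˡ-≤-pos +0 (coeff p i) a
  (subst₂ _≤_ (sym (ℤP.*-zeroʳ a)) (coeff-scale a p i) (N i))

Nonneg-sdCount : ∀ {A : Set} d (h : A → ℕ) xs → (∀ {x} → x ∈ xs → h x ℕ.< d) →
                 Nonneg d (countBy h xs) → Nonneg d (sdCount h xs)
Nonneg-sdCount zero    h xs h<d N i ()
Nonneg-sdCount (suc n) h xs h<d N i _ =
  NonnegCoeffs-scale⁻¹ (+ (2 ^ n)) {{ℤ.positive (ℤ.+<+ (ℕP.m^n>0 2 n))}} (hscPoly (suc n) (sdCount h xs))
    (NonnegCoeffs-resp-≈ (möbius-hscPoly-countBy n h xs (λ x∈ → ℕP.≤-pred (h<d x∈)))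
      (NonnegCoeffs-möbius n (hscPoly (suc n) (countBy h xs)) (Nonneg⇒NonnegCoeffs n (countBy h xs) N)))
    i

Nonneg-cong : ∀ d {f g} → (∀ j → f j ≡ g j) → Nonneg d f → Nonneg d g
Nonneg-cong d {f} {g} f≗g nonneg i i<d =
  subst (+ 0 ≤_) (coeff-≡ (lincomb-cong d (hscBasis (d ∸ 1)) f≗g) i) (nonneg i i<d)

2^-injective : ∀ {a b} → 2 ^ a ≡ 2 ^ b → a ≡ b
2^-injective {a} {b} e = trans (sym (⌊log₂[2^n]⌋≡n a)) (trans (cong ⌊log₂_⌋ e) (⌊log₂[2^n]⌋≡n b))

T-ext : ∀ {a b} → (T a → T b) → (T b → T a) → a ≡ b
T-ext {false} {false} _ _ = refl
T-ext {false} {true}  _ g = ⊥-elim (g _)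
T-ext {true}  {false} f _ = ⊥-elim (f _)
T-ext {true}  {true}  _ _ = refl

if-id : ∀ b → (if b then true else false) ≡ b
if-id true  = refl
if-id false = refl

Preimage : ∀ {N} (F : Cell N) → CubeFace (dim F) → Fin N → Set
Preimage (m , φ) q v = ∃ λ c → T (inCubeFace q c) × φ c ≡ v

lookup-faceImage : ∀ {N} (F : Cell N) q v →
  V.lookup (faceImage F q) v ≡ any (λ c → inCubeFace q c ∧ ⌊ proj₂ F c FinP.≟ v ⌋) (cubeVertices (dim F))
lookup-faceImage (m , φ) q v = trans (VP.lookup∘tabulate _ v) (if-id _)

∈-faceImage⁻ : ∀ {N} (F : Cell N) q {v} → v Sb.∈ faceImage F q → Preimage F q v
∈-faceImage⁻ F@(m , φ) q {v} v∈
  with satisfied (any⁻ (λ c → inCubeFace q c ∧ ⌊ φ c FinP.≟ v ⌋) (cubeVertices m)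
                       (Equivalence.from T-≡ (trans (sym (lookup-faceImage F q v)) (VP.[]=⇒lookup v∈))))
... | c , c∈q∧φc≡v with Equivalence.to (T-∧ {inCubeFace q c}) c∈q∧φc≡v
...   | c∈q , φc≡v = c , c∈q , toWitness {a? = φ c FinP.≟ v} φc≡v

∈-faceImage⁺ : ∀ {N} (F : Cell N) q {v} → Preimage F q v → v Sb.∈ faceImage F q
∈-faceImage⁺ F@(m , φ) q {v} (c , c∈q , refl) = VP.lookup⇒[]= v (faceImage F q)
  (trans (lookup-faceImage F q v)
         (Equivalence.to T-≡ (any⁺ (λ c → inCubeFace q c ∧ ⌊ φ c FinP.≟ v ⌋)
           (lose (∈-cubeVertices c) (Equivalence.from T-∧ (c∈q , fromWitness refl))))))

InjectiveCell : ∀ {N} → Cell N → Set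
InjectiveCell F = ∀ c c' → proj₂ F c ≡ proj₂ F c' → c ≡ c'

vertexLabels : ∀ {N} (F : Cell N) → CubeFace (dim F) → List (Fin N)
vertexLabels F q = map (proj₂ F) (faceVertices q)

∈-vertexLabels⁺ : ∀ {N} (F : Cell N) q {v} → Preimage F q v → v ∈ vertexLabels F q
∈-vertexLabels⁺ (m , φ) q (c , c∈q , refl) =
  ∈-map⁺ φ (∈-filter⁺ (λ c → T? (inCubeFace q c)) (∈-cubeVertices c) c∈q)

∈-vertexLabels⁻ : ∀ {N} (F : Cell N) q {v} → v ∈ vertexLabels F q → Preimage F q v
∈-vertexLabels⁻ (m , φ) q v∈ with ∈-map⁻ φ v∈
... | c , c∈ , refl = c , proj₂ (∈-filter⁻ (λ c → T? (inCubeFace q c)) {xs = cubeVertices m} c∈) , refl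

vertexLabels-unique : ∀ {N} (F : Cell N) → InjectiveCell F → ∀ q → Unique (vertexLabels F q)
vertexLabels-unique (m , φ) inj q =
  UniqueP.map⁺ (inj _ _) (UniqueP.filter⁺ (λ c → T? (inCubeFace q c)) (cubeVertices-unique m))

length-vertexLabels : ∀ {N} (F : Cell N) q → length (vertexLabels F q) ≡ 2 ^ faceDim q
length-vertexLabels F q = trans (length-map (proj₂ F) (faceVertices q)) (length-faceVertices q)

-- Equal vertex sets have equally many vertices, and a face of dimension k has 2^k of them.
faceImage-≡⇒faceDim-≡ : ∀ {N} (F G : Cell N) → InjectiveCell F → InjectiveCell G →
  ∀ p q → faceImage F p ≡ faceImage G q → faceDim p ≡ faceDim q
faceImage-≡⇒faceDim-≡ F G injF injG p q eq = 2^-injective (begin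
  2 ^ faceDim p
    ≡⟨ length-vertexLabels F p ⟨
  length (vertexLabels F p)
    ≡⟨ Unique-sameElements⇒length≡ (vertexLabels-unique F injF p) (vertexLabels-unique G injG q)
                                   (transport F G p q eq) (transport G F q p (sym eq)) ⟩
  length (vertexLabels G q)
    ≡⟨ length-vertexLabels G q ⟩
  2 ^ faceDim q ∎)
  where
  open ≡-Reasoning
  transport : ∀ F G p q → faceImage F p ≡ faceImage G q →
              ∀ {v} → v ∈ vertexLabels F p → v ∈ vertexLabels G q
  transport F G p q eq v∈ = ∈-vertexLabels⁺ G q
    (∈-faceImage⁻ G q (subst (_ Sb.∈_) eq (∈-faceImage⁺ F p (∈-vertexLabels⁻ F p v∈))))

dim≡faceDim : ∀ {N} (F G : Cell N) → InjectiveCell F → InjectiveCell G →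
  ∀ q → vset F ≡ faceImage G q → dim F ≡ faceDim q
dim≡faceDim F G injF injG q eq =
  trans (sym (faceDim-fullFace (dim F))) (faceImage-≡⇒faceDim-≡ F G injF injG (fullFace (dim F)) q eq)

faceImage-injective : ∀ {N} (G : Cell N) → InjectiveCell G →
                      ∀ {q q'} → faceImage G q ≡ faceImage G q' → q ≡ q'
faceImage-injective G inj {q} {q'} eq =
  inCubeFace-injective q q' (λ c → T-ext (transport {q} {q'} eq c) (transport {q'} {q} (sym eq) c))
  where
  transport : ∀ {q q'} → faceImage G q ≡ faceImage G q' → ∀ c → T (inCubeFace q c) → T (inCubeFace q' c)
  transport {q} {q'} eq c c∈q with ∈-faceImage⁻ G q' (subst (_ Sb.∈_) eq (∈-faceImage⁺ G q (c , c∈q , refl)))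
  ... | c' , c'∈q' , φc'≡φc = subst (λ c → T (inCubeFace q' c)) (inj c' c φc'≡φc) c'∈q'

faceImage⊆vset : ∀ {N} (G : Cell N) q → faceImage G q Sb.⊆ vset G
faceImage⊆vset G q v∈ with ∈-faceImage⁻ G q v∈
... | c , _ , φc≡v = ∈-faceImage⁺ G (fullFace (dim G)) (c , ∈-fullFace c , φc≡v)

vset≢⊥ : ∀ {N} (F : Cell N) → ¬ vset F ≡ Sb.⊥
vset≢⊥ F eq =
  SbP.∉⊥ (subst (proj₂ F c Sb.∈_) eq (∈-faceImage⁺ F (fullFace (dim F)) (c , ∈-fullFace c , refl)))
  where c = V.replicate (dim F) false

⊆⇒∩≡ : ∀ {N} {p q : Sb.Subset N} → p Sb.⊆ q → p Sb.∩ q ≡ p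
⊆⇒∩≡ {p = p} {q} p⊆q = SbP.⊆-antisym (SbP.p∩q⊆p p q) (λ x∈p → SbP.x∈p∩q⁺ (x∈p , p⊆q x∈p))

codim≡ : ∀ {m} (q : CubeFace m) j → m ≡ faceDim q ℕ.+ j → codim q ≡ j
codim≡ q j e = ℕP.+-cancelˡ-≡ (faceDim q) (codim q) j (trans (faceDim+codim q) e)

T-does⁺ : ∀ {P : Set} (P? : Dec P) → P → T (does P?)
T-does⁺ P? p = Equivalence.from T-≡ (dec-true P? p)

T-does⁻ : ∀ {P : Set} (P? : Dec P) → T (does P?) → P
T-does⁻ (yes p) _ = p

module _ {N} (K : CubicalComplex N) where

  isCodimFace : Cell N → ℕ → Cell N → Bool
  isCodimFace G j F = does (vset F SbP.⊆? vset G) ∧ does (dim G ≟ dim F ℕ.+ j)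

  codimFaces : Cell N → ℕ → List (Cell N)
  codimFaces G j = filterᵇ (isCodimFace G j) (faces K)

  ∈-codimFaces⁻ : ∀ {G F j} → F ∈ codimFaces G j →
                  F ∈ faces K × vset F Sb.⊆ vset G × dim G ≡ dim F ℕ.+ j
  ∈-codimFaces⁻ {G} {F} {j} F∈codim =
    F∈ , T-does⁻ (vset F SbP.⊆? vset G) F⊆G? , T-does⁻ (dim G ≟ dim F ℕ.+ j) dimG≡?
    where
    F∈ = proj₁ (∈-filter⁻ (λ F → T? (isCodimFace G j F)) {xs = faces K} F∈codim)
    isCodim = proj₂ (∈-filter⁻ (λ F → T? (isCodimFace G j F)) {xs = faces K} F∈codim)
    F⊆G? = proj₁ (Equivalence.to (T-∧ {does (vset F SbP.⊆? vset G)}) isCodim)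
    dimG≡? = proj₂ (Equivalence.to (T-∧ {does (vset F SbP.⊆? vset G)}) isCodim)

  ∈-codimFaces⁺ : ∀ {G F j} → F ∈ faces K → vset F Sb.⊆ vset G → dim G ≡ dim F ℕ.+ j →
                  F ∈ codimFaces G j
  ∈-codimFaces⁺ {G} {F} {j} F∈ F⊆G dimG≡ = ∈-filter⁺ (λ F → T? (isCodimFace G j F)) F∈
    (Equivalence.from T-∧ (T-does⁺ (vset F SbP.⊆? vset G) F⊆G , T-does⁺ (dim G ≟ dim F ℕ.+ j) dimG≡))

  -- Uses that F ∩ G is a face of G and that vertex sets determine dimensions.
  codimFaces⇒faceImage : ∀ {G F} j → G ∈ faces K → F ∈ codimFaces G j →
                         ∃ λ q → codim q ≡ j × vset F ≡ faceImage G q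
  codimFaces⇒faceImage {G} {F} j G∈ F∈codim = fromIntersection (intersect K F∈ G∈)
    where
    F∈    = proj₁ (∈-codimFaces⁻ {G} {F} {j} F∈codim)
    F⊆G   = proj₁ (proj₂ (∈-codimFaces⁻ {G} {F} {j} F∈codim))
    dimG≡ = proj₂ (proj₂ (∈-codimFaces⁻ {G} {F} {j} F∈codim))
    fromIntersection : (vset F Sb.∩ vset G ≡ Sb.⊥) ⊎
                       (∃ λ p → ∃ λ q → vset F Sb.∩ vset G ≡ faceImage F p ×
                                        vset F Sb.∩ vset G ≡ faceImage G q) →
                       ∃ λ q → codim q ≡ j × vset F ≡ faceImage G q
    fromIntersection (inj₁ F∩G≡⊥) = ⊥-elim (vset≢⊥ F (trans (sym (⊆⇒∩≡ F⊆G)) F∩G≡⊥))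
    fromIntersection (inj₂ (_ , q , _ , F∩G≡q)) = q , codim≡ q j dimG≡faceDim+j , vsetF≡q
      where
      vsetF≡q = trans (sym (⊆⇒∩≡ F⊆G)) F∩G≡q
      dimG≡faceDim+j =
        trans dimG≡ (cong (ℕ._+ j) (dim≡faceDim F G (injective K F∈) (injective K G∈) q vsetF≡q))

  faceImage⇒codimFaces : ∀ {G} q → G ∈ faces K →
                         ∃ λ F → F ∈ codimFaces G (codim q) × vset F ≡ faceImage G q
  faceImage⇒codimFaces {G} q G∈ with faceClosed K G∈ q
  ... | F , F∈ , vsetF≡q = F , ∈-codimFaces⁺ {G} F∈ F⊆G dimG≡ , vsetF≡q
    where
    F⊆G = subst (Sb._⊆ vset G) (sym vsetF≡q) (faceImage⊆vset G q)
    dimG≡ = trans (sym (faceDim+codim q))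
      (cong (ℕ._+ codim q) (sym (dim≡faceDim F G (injective K F∈) (injective K G∈) q vsetF≡q)))

  length-codimFaces : ∀ {G} j → G ∈ faces K →
                      length (codimFaces G j) ≡ countBy codim (cubeFaces (dim G)) j
  length-codimFaces {G} j G∈ = begin
    length (codimFaces G j)               ≡⟨ length-map vset (codimFaces G j) ⟨
    length (map vset (codimFaces G j))    ≡⟨ Unique-sameElements⇒length≡ vsets-unique images-unique to from ⟩
    length (map (faceImage G) Q)          ≡⟨ length-map (faceImage G) Q ⟩
    length Q                              ∎
    where
    open ≡-Reasoning
    Q = filter (λ q → codim q ≟ j) (cubeFaces (dim G))
    vsets-unique : Unique (map vset (codimFaces G j))
    vsets-unique =
      AllPairsP.map⁺ (AllPairsP.filter⁺ (λ F → T? (isCodimFace G j F)) (AllPairsP.map⁻ (distinct K)))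
    images-unique : Unique (map (faceImage G) Q)
    images-unique = UniqueP.map⁺ (faceImage-injective G (injective K G∈))
                                 (UniqueP.filter⁺ (λ q → codim q ≟ j) (cubeFaces-unique (dim G)))
    to : ∀ {S} → S ∈ map vset (codimFaces G j) → S ∈ map (faceImage G) Q
    to S∈ with ∈-map⁻ vset S∈
    ... | F , F∈codim , refl with codimFaces⇒faceImage j G∈ F∈codim
    ...   | q , codim≡j , vsetF≡q =
      subst (_∈ map (faceImage G) Q) (sym vsetF≡q)
            (∈-map⁺ (faceImage G) (∈-filter⁺ (λ q → codim q ≟ j) (∈-cubeFaces q) codim≡j))
    from : ∀ {S} → S ∈ map (faceImage G) Q → S ∈ map vset (codimFaces G j)
    from S∈ with ∈-map⁻ (faceImage G) S∈
    ... | q , q∈Q , refl with ∈-filter⁻ (λ q → codim q ≟ j) {xs = cubeFaces (dim G)} q∈Q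
    ...   | _ , refl with faceImage⇒codimFaces q G∈
    ...     | F , F∈codim , vsetF≡q = subst (_∈ map vset (codimFaces G j)) vsetF≡q (∈-map⁺ vset F∈codim)

fvecSd≡sdCount : ∀ {N} (K : CubicalComplex N) j → fvecSd K j ≡ sdCount dim (faces K) j
fvecSd≡sdCount K j = trans (length-filterᵇ-cartesianProduct _ (faces K) (faces K))
                           (Σℕ-cong (faces K) (λ G∈ → length-codimFaces K j G∈))

corollary3p3 : (N d : ℕ) (K : CubicalComplex N) → HasDim K d →
    Nonneg d (fvec K) → Nonneg d (fvecSd K)
corollary3p3 N d K (dim<d , _) nonneg =
  Nonneg-cong d (λ j → sym (fvecSd≡sdCount K j)) (Nonneg-sdCount d dim (faces K) dim<d nonneg)
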